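{- Let $B$ be a unital algebra over a field of characteristic zero. The set $G^I_B=I\cdot G^{\mathrm{inv}}_B$ is a subgroup of $(G^{\mathrm{dif}}_B,\circ)$; in particular it is a group under composition $\circ$.
   Context: $\mathrm{Mult}[[B]]$: sequences $f=(f_n)_{n\ge0}$ with $f_n:B^n\to B$ multilinear ($f_0\in B$). Product: $(f\cdot g)_n(x_1,\dots,x_n)=\sum_{k=0}^n f_k(x_1,\dots,x_k)g_{n-k}(x_{k+1},\dots,x_n)$. For $g_0=0$, composition $(f\circ g)_n(x_1,\dots,x_n)=\sum_{l\ge0}\sum_{k_1+\dots+k_l=n,\,k_i\ge1}f_l(g_{k_1}(x_1,\dots,x_{k_1}),\dots,g_{k_l}(x_{n-k_l+1},\dots,x_n))$. $I$: $I_1=\mathrm{Id}_B$, $I_n=0$ for $n\ne1$. $G^{\mathrm{inv}}_B=\{f:f_0\in B^\times\}$; $G^{\mathrm{dif}}_B=\{f:f_0=0,f_1\in GL(B)\}$, a group under $\circ$. -}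

module Defs where

open import Level using (Level; _⊔_) renaming (suc to lsuc)
open import Data.Nat using (ℕ; zero; suc)
open import Data.Fin using (Fin)
import Data.Fin as F
open import Data.List using (List; []; _∷_; map; foldr; concatMap; upTo)
open import Data.Product using (Σ; ∃; _×_; _,_)
open import Data.Vec.Functional using (Vector; updateAt; tail)
import Data.Vec.Functional as V
open import Function using (const)
open import Function.Definitions using (Bijective)
open import Relation.Binary.PropositionalEquality using (_≡_)
open import Relation.Nullary using (¬_)
open import Algebra.Bundles using (CommutativeRing; Ring)
open import Algebra.Module.Structures using (IsLeftModule)
import Algebra.Definitions.RawMonoid as RawMonoidDefs

module _ {k ℓk : Level} (K : CommutativeRing k ℓk) where
  open CommutativeRing K

  record IsField : Set (k ⊔ ℓk) where
    field
      1≉0     : ¬ (1# ≈ 0#)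
      inverse : ∀ x → ¬ (x ≈ 0#) → ∃ λ y → (x * y) ≈ 1#

  CharZero : Set ℓk
  CharZero = ∀ (n : ℕ) → RawMonoidDefs._×_ +-rawMonoid n 1# ≈ 0# → n ≡ 0

record UnitalAlgebra {k ℓk : Level} (K : CommutativeRing k ℓk) (b ℓb : Level)
       : Set (k ⊔ ℓk ⊔ lsuc (b ⊔ ℓb)) where
  module K = CommutativeRing K
  field
    ring : Ring b ℓb
  open Ring ring
  field
    _·_          : K.Carrier → Carrier → Carrier
    isLeftModule : IsLeftModule K.ring _≈_ _+_ 0# -_ _·_
    ·-*-assocˡ   : ∀ c x y → ((c · x) * y) ≈ (c · (x * y))
    ·-*-assocʳ   : ∀ c x y → (x * (c · y)) ≈ (c · (x * y))

module Mult {k ℓk b ℓb : Level} {K : CommutativeRing k ℓk}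
            (A : UnitalAlgebra K b ℓb) where
  open UnitalAlgebra A
  open Ring ring renaming (Carrier to B)

  Map : ℕ → Set b
  Map n = Vector B n → B

  record Multilinear {n : ℕ} (f : Map n) : Set (k ⊔ b ⊔ ℓb) where
    field
      cong : ∀ (v w : Vector B n) → (∀ i → v i ≈ w i) → f v ≈ f w
      additive : ∀ (v : Vector B n) (i : Fin n) (x y : B) →
        f (updateAt v i (const (x + y)))
          ≈ (f (updateAt v i (const x)) + f (updateAt v i (const y)))
      homogeneous : ∀ (v : Vector B n) (i : Fin n) (c : K.Carrier) (x : B) →
        f (updateAt v i (const (c · x))) ≈ (c · f (updateAt v i (const x)))

  Series : Set b
  Series = (n : ℕ) → Map n

  IsMult : Series → Set (k ⊔ b ⊔ ℓb)
  IsMult f = ∀ n → Multilinear (f n)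

  _≋_ : Series → Series → Set (b ⊔ ℓb)
  f ≋ g = ∀ n (x : Vector B n) → f n x ≈ g n x

  ∑ : List B → B
  ∑ = foldr _+_ 0#

  -- all splittings of (x_1..x_n) into a prefix (x_1..x_k) and suffix
  -- (x_{k+1}..x_n), for k = 0, 1, ..., n (in this order)
  Split : Set b
  Split = Σ ℕ λ k → Vector B k × Σ ℕ λ m → Vector B m

  splits : (n : ℕ) → Vector B n → List Split
  splits zero    x = (0 , V.[] , 0 , x) ∷ []
  splits (suc n) x = (0 , V.[] , suc n , x)
    ∷ map (λ { (k , p , m , s) → (suc k , (x F.zero V.∷ p) , m , s) })
          (splits n (tail x))

  I : Series
  I zero          x = 0#
  I (suc zero)    x = x F.zero
  I (suc (suc n)) x = 0#

  -- product: (f·g)_n(x) = Σ_{k=0}^n f_k(x_1..x_k) g_{n-k}(x_{k+1}..x_n)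
  _⋆_ : Series → Series → Series
  (f ⋆ g) n x = ∑ (map (λ { (k , p , m , s) → f k p * g m s }) (splits n x))

  -- for a composition (k_1,...,k_l) of n (all k_i ≥ 1), the vector
  -- (g_{k_1}(x_1..x_{k_1}), ..., g_{k_l}(x_{n-k_l+1}..x_n)); blocks g l n x
  -- lists these vectors over all compositions of n into l positive parts
  blocks : Series → (l n : ℕ) → Vector B n → List (Vector B l)
  blocks g zero zero    x = V.[] ∷ []
  blocks g zero (suc n) x = []
  blocks g (suc l) n x = concatMap step (splits n x)
    where
    step : Split → List (Vector B (suc l))
    step (zero  , p , m , s) = []
    step (suc k , p , m , s) = map (g (suc k) p V.∷_) (blocks g l m s)

  -- composition: (f∘g)_n(x) = Σ_l Σ_{k_1+..+k_l=n, k_i≥1}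
  --    f_l(g_{k_1}(..), ..., g_{k_l}(..)); only l ≤ n contribute.
  _⊚_ : Series → Series → Series
  (f ⊚ g) n x = ∑ (map (λ l → ∑ (map (f l) (blocks g l n x))) (upTo (suc n)))

  IsUnit : B → Set (b ⊔ ℓb)
  IsUnit u = ∃ λ v → ((u * v) ≈ 1#) × ((v * u) ≈ 1#)

  Ginv : Series → Set (k ⊔ b ⊔ ℓb)
  Ginv f = IsMult f × IsUnit (f 0 V.[])

  -- G^dif_B = { f ∈ Mult[[B]] : f_0 = 0, f_1 ∈ GL(B) }
  -- (f_1 is K-linear by multilinearity; GL = bijective)
  Gdif : Series → Set (k ⊔ b ⊔ ℓb)
  Gdif f = IsMult f × (f 0 V.[] ≈ 0#)
         × Bijective _≈_ _≈_ (λ x → f 1 (x V.∷ V.[]))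

  GI : Series → Set (k ⊔ b ⊔ ℓb)
  GI g = ∃ λ f → Ginv f × (g ≋ (I ⋆ f))

  record IsSubgroupOfGdif (P : Series → Set (k ⊔ b ⊔ ℓb))
         : Set (k ⊔ lsuc b ⊔ lsuc ℓb ⊔ lsuc k) where
    field
      ⊆Gdif   : ∀ g → P g → Gdif g
      has-I   : P I
      ⊚-closed : ∀ g h → P g → P h → P (g ⊚ h)
      inv-closed : ∀ g → P g → ∃ λ h → P h × ((g ⊚ h) ≋ I) × ((h ⊚ g) ≋ I)

{-# OPTIONS --safe #-}
-- Write g ∈ I·G^inv as g₀ = 0, g_{n+1}(x₁, …) = x₁ f_n(x₂, …).  Intrinsically: g is a multilinear
-- series with g₀ = 0 whose components g_{n+1} are left B-linear in their first argument, and whose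
-- linear term g₁(x) = x u has u a unit (then f_n(x) = g_{n+1}(1, x) and u = f₀).  Both conditions
-- survive composition: the first block h_{k₁}(x₁, …) of (g ∘ h)_n(x) is left linear in x₁, and g_l
-- is left linear in its first block; the linear term of g ∘ h is x u_h u_g.
--
-- Composition is associative on multilinear series, because the blocks of a composite are blocks
-- of blocks, and I is a two-sided unit.  A right inverse h of g is found degree by degree: in
-- (g ∘ h)_{n+1} = h_{n+1} u + Σ_{l ≥ 2} (terms involving only h_j, j ≤ n), so
-- h_{n+1} = (I_{n+1} − Σ_{l ≥ 2} …) u⁻¹.  This h is again of the same shape, so it has a right
-- inverse too, and associativity makes h a two-sided inverse.
module Submission where

open import Defs
open import Level using (Level; _⊔_)
open import Data.Nat using (ℕ; zero; suc; _≤_; _<_; z≤n; s≤s; _∸_) renaming (_+_ to _+ℕ_)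
import Data.Nat.Properties as ℕ
open import Data.Fin using (Fin)
import Data.Fin as F
open import Data.List using (List; []; _∷_; map; concatMap; upTo; applyUpTo; _++_)
open import Data.List.Properties using (map-++; map-∘; map-upTo; map-applyUpTo)
open import Data.Product using (Σ; _×_; _,_)
open import Data.Vec.Functional using (Vector; updateAt; tail)
import Data.Vec.Functional as V
open import Function using (const; _∘_)
import Relation.Binary.PropositionalEquality as ≡
open import Relation.Binary.PropositionalEquality using (_≡_)
open import Relation.Nullary using (¬_)
open import Data.Empty using (⊥-elim)
open import Algebra.Bundles using (CommutativeRing; Ring)
open import Algebra.Module.Structures using (IsLeftModule)
open import Data.Nat.Induction using (<-rec)

module _ {k ℓk b ℓb : Level} {K : CommutativeRing k ℓk} (A : UnitalAlgebra K b ℓb) where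
  open UnitalAlgebra A
  open Ring ring renaming (Carrier to B)
  open Mult A
  open import Relation.Binary.Reasoning.Setoid setoid
  open import Algebra.Properties.Ring ring using (-‿distribʳ-*)
  open import Algebra.Properties.CommutativeSemigroup +-commutativeSemigroup using (interchange)
  open import Algebra.Properties.AbelianGroup +-abelianGroup using (⁻¹-∙-comm)
  open import Algebra.Properties.Group +-group using (identityʳ-unique; inverseˡ-unique; ε⁻¹≈ε)
  open IsLeftModule isLeftModule using (*ₗ-cong; *ₗ-zeroʳ; *ₗ-distribˡ)

  private variable
    a : Level
    X Y : Set a

  ∑map-cong : ∀ {F G : X → B} (xs : List X) → (∀ e → F e ≈ G e) → ∑ (map F xs) ≈ ∑ (map G xs)
  ∑map-cong []       eq = refl
  ∑map-cong (e ∷ xs) eq = +-cong (eq e) (∑map-cong xs eq)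

  ∑map-zero : ∀ {F : X → B} (xs : List X) → (∀ e → F e ≈ 0#) → ∑ (map F xs) ≈ 0#
  ∑map-zero []       eq = refl
  ∑map-zero (e ∷ xs) eq = trans (+-cong (eq e) (∑map-zero xs eq)) (+-identityˡ 0#)

  ∑map-+ : ∀ (F G : X → B) (xs : List X) → ∑ (map (λ e → F e + G e) xs) ≈ ∑ (map F xs) + ∑ (map G xs)
  ∑map-+ F G []       = sym (+-identityˡ 0#)
  ∑map-+ F G (e ∷ xs) = trans (+-congˡ (∑map-+ F G xs)) (interchange _ _ _ _)

  ∑map-swap : ∀ (F : X → Y → B) (xs : List X) (ys : List Y) →
    ∑ (map (λ e → ∑ (map (F e) ys)) xs) ≈ ∑ (map (λ d → ∑ (map (λ e → F e d) xs)) ys)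
  ∑map-swap F []       ys = sym (∑map-zero ys (λ _ → refl))
  ∑map-swap F (e ∷ xs) ys = trans (+-congˡ (∑map-swap F xs ys)) (sym (∑map-+ (F e) _ ys))

  ∑-++ : ∀ (xs ys : List B) → ∑ (xs ++ ys) ≈ ∑ xs + ∑ ys
  ∑-++ []       ys = sym (+-identityˡ _)
  ∑-++ (u ∷ xs) ys = trans (+-congˡ (∑-++ xs ys)) (sym (+-assoc _ _ _))

  ∑map-concatMap : ∀ (F : Y → B) (f : X → List Y) (xs : List X) →
    ∑ (map F (concatMap f xs)) ≈ ∑ (map (λ e → ∑ (map F (f e))) xs)
  ∑map-concatMap F f []       = refl
  ∑map-concatMap F f (e ∷ xs) = begin
    ∑ (map F (f e ++ concatMap f xs))            ≡⟨ ≡.cong ∑ (map-++ F (f e) _) ⟩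
    ∑ (map F (f e) ++ map F (concatMap f xs))    ≈⟨ ∑-++ (map F (f e)) _ ⟩
    ∑ (map F (f e)) + ∑ (map F (concatMap f xs)) ≈⟨ +-congˡ (∑map-concatMap F f xs) ⟩
    ∑ (map (λ e → ∑ (map F (f e))) (e ∷ xs))     ∎

  additive-∑map : ∀ (Ψ : B → B) → Ψ 0# ≈ 0# → (∀ u v → Ψ (u + v) ≈ Ψ u + Ψ v) →
    ∀ (F : X → B) (xs : List X) → Ψ (∑ (map F xs)) ≈ ∑ (map (λ e → Ψ (F e)) xs)
  additive-∑map Ψ Ψ-0 Ψ-+ F []       = Ψ-0
  additive-∑map Ψ Ψ-0 Ψ-+ F (e ∷ xs) = trans (Ψ-+ _ _) (+-congˡ (additive-∑map Ψ Ψ-0 Ψ-+ F xs))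

  ∑applyUpTo-zero : ∀ (F : ℕ → B) N → (∀ i → i < N → F i ≈ 0#) → ∑ (applyUpTo F N) ≈ 0#
  ∑applyUpTo-zero F zero    eq = refl
  ∑applyUpTo-zero F (suc N) eq = trans
    (+-cong (eq 0 (s≤s z≤n)) (∑applyUpTo-zero (F ∘ suc) N (λ i i<N → eq (suc i) (s≤s i<N)))) (+-identityˡ 0#)

  ∑applyUpTo-cong : ∀ {F G : ℕ → B} N → (∀ i → i < N → F i ≈ G i) →
    ∑ (applyUpTo F N) ≈ ∑ (applyUpTo G N)
  ∑applyUpTo-cong zero    eq = refl
  ∑applyUpTo-cong (suc N) eq = +-cong (eq 0 (s≤s z≤n)) (∑applyUpTo-cong N (λ i i<N → eq (suc i) (s≤s i<N)))

  ∑applyUpTo-extend : ∀ (F : ℕ → B) N M → N ≤ M → (∀ i → N ≤ i → F i ≈ 0#) →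
    ∑ (applyUpTo F N) ≈ ∑ (applyUpTo F M)
  ∑applyUpTo-extend F zero    M       N≤M     eq = sym (∑applyUpTo-zero F M (λ i _ → eq i z≤n))
  ∑applyUpTo-extend F (suc N) (suc M) (s≤s N≤M) eq =
    +-congˡ (∑applyUpTo-extend (F ∘ suc) N M N≤M (λ i N≤i → eq (suc i) (s≤s N≤i)))

  ∑applyUpTo-snoc : ∀ (F : ℕ → B) N → ∑ (applyUpTo F (suc N)) ≈ ∑ (applyUpTo F N) + F N
  ∑applyUpTo-snoc F zero    = trans (+-identityʳ _) (sym (+-identityˡ _))
  ∑applyUpTo-snoc F (suc N) = trans (+-congˡ (∑applyUpTo-snoc (F ∘ suc) N)) (sym (+-assoc _ _ _))

  ∑map-applyUpTo : ∀ (F : ℕ → B) (f : ℕ → ℕ) N → ∑ (map F (applyUpTo f N)) ≡ ∑ (applyUpTo (F ∘ f) N)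
  ∑map-applyUpTo F f N = ≡.cong ∑ (map-applyUpTo f F N)

  -- in the shape of the outer sum of _⊚_, so that (f ⊚ g) n x is literally ∑< (suc n) …
  ∑< : ℕ → (ℕ → B) → B
  ∑< N F = ∑ (map F (upTo N))

  ∑<-applyUpTo : ∀ N F → ∑< N F ≡ ∑ (applyUpTo F N)
  ∑<-applyUpTo N F = ≡.cong ∑ (map-upTo F N)

  ∑<-suc : ∀ N F → ∑< (suc N) F ≈ F 0 + ∑< N (F ∘ suc)
  ∑<-suc N F = +-congˡ (reflexive (≡.trans (∑map-applyUpTo F suc N) (≡.sym (∑<-applyUpTo N (F ∘ suc)))))

  ∑<-cong : ∀ N {F G} → (∀ i → i < N → F i ≈ G i) → ∑< N F ≈ ∑< N G
  ∑<-cong N {F} {G} eq = begin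
    ∑< N F               ≡⟨ ∑<-applyUpTo N F ⟩
    ∑ (applyUpTo F N)    ≈⟨ ∑applyUpTo-cong N eq ⟩
    ∑ (applyUpTo G N)    ≡⟨ ∑<-applyUpTo N G ⟨
    ∑< N G               ∎

  ∑<-extend : ∀ N M F → N ≤ M → (∀ i → N ≤ i → F i ≈ 0#) → ∑< N F ≈ ∑< M F
  ∑<-extend N M F N≤M eq = begin
    ∑< N F               ≡⟨ ∑<-applyUpTo N F ⟩
    ∑ (applyUpTo F N)    ≈⟨ ∑applyUpTo-extend F N M N≤M eq ⟩
    ∑ (applyUpTo F M)    ≡⟨ ∑<-applyUpTo M F ⟨
    ∑< M F               ∎

  ∑<-zero : ∀ N {F} → (∀ i → F i ≈ 0#) → ∑< N F ≈ 0#
  ∑<-zero N eq = ∑map-zero (upTo N) eq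

  _≈v_ : ∀ {n} → Vector B n → Vector B n → Set ℓb
  x ≈v y = ∀ i → x i ≈ y i

  Congruentᵛ : ∀ {n} → Map n → Set (b ⊔ ℓb)
  Congruentᵛ {n} Φ = ∀ {x y : Vector B n} → x ≈v y → Φ x ≈ Φ y

  Congruentˢ : Series → Set (b ⊔ ℓb)
  Congruentˢ h = ∀ n → Congruentᵛ (h n)

  ≈v-refl : ∀ {n} {x : Vector B n} → x ≈v x
  ≈v-refl i = refl

  ≈v-sym : ∀ {n} {x y : Vector B n} → x ≈v y → y ≈v x
  ≈v-sym x≈y i = sym (x≈y i)

  ≈v-trans : ∀ {n} {x y z : Vector B n} → x ≈v y → y ≈v z → x ≈v z
  ≈v-trans x≈y y≈z i = trans (x≈y i) (y≈z i)

  ∷-cong : ∀ {n} {a a' : B} {p p' : Vector B n} → a ≈ a' → p ≈v p' → (a V.∷ p) ≈v (a' V.∷ p')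
  ∷-cong a≈a' p≈p' F.zero    = a≈a'
  ∷-cong a≈a' p≈p' (F.suc i) = p≈p' i

  head∷tail≈v : ∀ {n} (x : Vector B (suc n)) → (x F.zero V.∷ tail x) ≈v x
  head∷tail≈v x F.zero    = refl
  head∷tail≈v x (F.suc i) = refl

  []≈v : ∀ (x y : Vector B 0) → x ≈v y
  []≈v x y ()

  shiftSplit : B → Split → Split
  shiftSplit a (k , p , m , s) = (suc k , a V.∷ p , m , s)

  ∑splits-suc : ∀ n x (F : Split → B) → ∑ (map F (splits (suc n) x)) ≈
    F (0 , V.[] , suc n , x) + ∑ (map (F ∘ shiftSplit (x F.zero)) (splits n (tail x)))
  ∑splits-suc n x F = +-congˡ (reflexive (≡.cong ∑ (≡.sym (map-∘ (splits n (tail x))))))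

  SplitCong : (Split → B) → Set (b ⊔ ℓb)
  SplitCong F = ∀ k p p' m s s' → p ≈v p' → s ≈v s' → F (k , p , m , s) ≈ F (k , p' , m , s')

  SplitCong-shift : ∀ {F} → SplitCong F → ∀ a → SplitCong (F ∘ shiftSplit a)
  SplitCong-shift F-cong a k p p' m s s' p≈p' s≈s' = F-cong (suc k) _ _ m s s' (∷-cong refl p≈p') s≈s'

  ∑splits-congᵛ : ∀ n {x y : Vector B n} (F : Split → B) → SplitCong F → x ≈v y →
    ∑ (map F (splits n x)) ≈ ∑ (map F (splits n y))
  ∑splits-congᵛ zero    F F-cong x≈y = +-congʳ (F-cong 0 _ _ 0 _ _ ([]≈v _ _) x≈y)
  ∑splits-congᵛ (suc n) {x} {y} F F-cong x≈y = begin
    ∑ (map F (splits (suc n) x))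
      ≈⟨ ∑splits-suc n x F ⟩
    F (0 , V.[] , suc n , x) + ∑ (map (F ∘ shiftSplit (x F.zero)) (splits n (tail x)))
      ≈⟨ +-cong (F-cong 0 _ _ (suc n) _ _ ([]≈v _ _) x≈y)
                (∑splits-congᵛ n _ (SplitCong-shift F-cong (x F.zero)) (x≈y ∘ F.suc)) ⟩
    F (0 , V.[] , suc n , y) + ∑ (map (F ∘ shiftSplit (x F.zero)) (splits n (tail y)))
      ≈⟨ +-congˡ (∑map-cong (splits n (tail y)) (λ (k , p , m , s) →
           F-cong (suc k) _ _ m s s (∷-cong (x≈y F.zero) ≈v-refl) ≈v-refl)) ⟩
    F (0 , V.[] , suc n , y) + ∑ (map (F ∘ shiftSplit (y F.zero)) (splits n (tail y)))
      ≈⟨ ∑splits-suc n y F ⟨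
    ∑ (map F (splits (suc n) y)) ∎

  ∑splits-cong : ∀ n (x : Vector B n) (F G : Split → B) →
    (∀ k p m s → k +ℕ m ≡ n → F (k , p , m , s) ≈ G (k , p , m , s)) →
    ∑ (map F (splits n x)) ≈ ∑ (map G (splits n x))
  ∑splits-cong zero    x F G eq = +-congʳ (eq 0 _ 0 _ ≡.refl)
  ∑splits-cong (suc n) x F G eq = begin
    ∑ (map F (splits (suc n) x))
      ≈⟨ ∑splits-suc n x F ⟩
    F (0 , V.[] , suc n , x) + ∑ (map (F ∘ shiftSplit (x F.zero)) (splits n (tail x)))
      ≈⟨ +-cong (eq 0 _ (suc n) _ ≡.refl)
                (∑splits-cong n (tail x) _ _ (λ k p m s k+m≡n → eq (suc k) _ m s (≡.cong suc k+m≡n))) ⟩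
    G (0 , V.[] , suc n , x) + ∑ (map (G ∘ shiftSplit (x F.zero)) (splits n (tail x)))
      ≈⟨ ∑splits-suc n x G ⟨
    ∑ (map G (splits (suc n) x)) ∎

  ∑splits-first : ∀ n (x : Vector B n) (F : Split → B) → (∀ k p m s → F (suc k , p , m , s) ≈ 0#) →
    ∑ (map F (splits n x)) ≈ F (0 , V.[] , n , x)
  ∑splits-first zero    x F F-0 = +-identityʳ _
  ∑splits-first (suc n) x F F-0 = trans (∑splits-suc n x F)
    (trans (+-congˡ (∑map-zero (splits n (tail x)) (λ (k , p , m , s) → F-0 k _ m s))) (+-identityʳ _))

  ∑splits-last : ∀ n (x : Vector B n) (F : Split → B) → SplitCong F →
    (∀ k p m s → F (k , p , suc m , s) ≈ 0#) → ∑ (map F (splits n x)) ≈ F (n , x , 0 , V.[])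
  ∑splits-last zero    x F F-cong F-0 = trans (+-identityʳ _) (F-cong 0 _ _ 0 _ _ ([]≈v _ _) ([]≈v _ _))
  ∑splits-last (suc n) x F F-cong F-0 = begin
    ∑ (map F (splits (suc n) x))
      ≈⟨ ∑splits-suc n x F ⟩
    F (0 , V.[] , suc n , x) + ∑ (map (F ∘ shiftSplit (x F.zero)) (splits n (tail x)))
      ≈⟨ +-cong (F-0 0 _ n x) (∑splits-last n (tail x) _ (SplitCong-shift F-cong (x F.zero))
                                 (λ k p m s → F-0 (suc k) _ m s)) ⟩
    0# + F (suc n , x F.zero V.∷ tail x , 0 , V.[])
      ≈⟨ +-identityˡ _ ⟩
    F (suc n , x F.zero V.∷ tail x , 0 , V.[])
      ≈⟨ F-cong (suc n) _ _ 0 _ _ (head∷tail≈v x) ≈v-refl ⟩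
    F (suc n , x , 0 , V.[]) ∎

  dropEmptyPrefix : (Split → B) → Split → B
  dropEmptyPrefix F (zero  , p , m , s) = 0#
  dropEmptyPrefix F (suc k , p , m , s) = F (suc k , p , m , s)

  ∑splits-peel : ∀ n (x : Vector B n) F →
    ∑ (map F (splits n x)) ≈ F (0 , V.[] , n , x) + ∑ (map (dropEmptyPrefix F) (splits n x))
  ∑splits-peel zero    x F = +-congˡ (sym (+-identityˡ 0#))
  ∑splits-peel (suc n) x F = trans (∑splits-suc n x F) (+-congˡ (trans
    (∑map-cong (splits n (tail x)) (λ (k , p , m , s) → refl))
    (trans (sym (+-identityˡ _)) (sym (∑splits-suc n x (dropEmptyPrefix F))))))

  TripleFn : Set b
  TripleFn = (K₁ : ℕ) → Vector B K₁ → (K₂ : ℕ) → Vector B K₂ → (M : ℕ) → Vector B M → B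

  resplitPrefix : TripleFn → (M : ℕ) → Vector B M → Split → B
  resplitPrefix H M S (K₁ , P₁ , K₂ , P₂) = H K₁ P₁ K₂ P₂ M S

  resplitSuffix : TripleFn → (K₁ : ℕ) → Vector B K₁ → Split → B
  resplitSuffix H K₁ P₁ (K₂ , P₂ , M , S) = H K₁ P₁ K₂ P₂ M S

  ∑resplitPrefix : TripleFn → Split → B
  ∑resplitPrefix H (K , P , M , S) = ∑ (map (resplitPrefix H M S) (splits K P))

  ∑resplitSuffix : TripleFn → Split → B
  ∑resplitSuffix H (K₁ , P₁ , M₁ , S₁) = ∑ (map (resplitSuffix H K₁ P₁) (splits M₁ S₁))

  -- both sides sum H over the ways of cutting x into three consecutive pieces
  ∑splits-assoc : ∀ n (x : Vector B n) (H : TripleFn) →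
    ∑ (map (∑resplitPrefix H) (splits n x)) ≈ ∑ (map (∑resplitSuffix H) (splits n x))
  ∑splits-assoc zero    x H = refl
  ∑splits-assoc (suc n) x H = begin
    ∑ (map (∑resplitPrefix H) (splits (suc n) x))
      ≈⟨ ∑splits-suc n x (∑resplitPrefix H) ⟩
    ∑resplitPrefix H (0 , V.[] , suc n , x) + ∑ (map (∑resplitPrefix H ∘ shiftSplit x₀) xs)
      ≈⟨ +-congˡ (∑map-cong xs (λ (k , p , m , s) → ∑splits-suc k (x₀ V.∷ p) (resplitPrefix H m s))) ⟩
    ∑resplitPrefix H (0 , V.[] , suc n , x) + ∑ (map (λ e → G e + ∑resplitPrefix H₀ e) xs)
      ≈⟨ +-cong (+-identityʳ _) (∑map-+ G (∑resplitPrefix H₀) xs) ⟩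
    H 0 V.[] 0 V.[] (suc n) x + (∑ (map G xs) + ∑ (map (∑resplitPrefix H₀) xs))
      ≈⟨ +-congˡ (+-congˡ (∑splits-assoc n (tail x) H₀)) ⟩
    H 0 V.[] 0 V.[] (suc n) x + (∑ (map G xs) + ∑ (map (∑resplitSuffix H₀) xs))
      ≈⟨ +-assoc _ _ _ ⟨
    (H 0 V.[] 0 V.[] (suc n) x + ∑ (map G xs)) + ∑ (map (∑resplitSuffix H₀) xs)
      ≈⟨ +-congʳ (trans (∑splits-suc n x (resplitSuffix H 0 V.[]))
                        (+-congˡ (∑map-cong xs (λ (k , p , m , s) → refl)))) ⟨
    ∑resplitSuffix H (0 , V.[] , suc n , x) + ∑ (map (∑resplitSuffix H ∘ shiftSplit x₀) xs)
      ≈⟨ ∑splits-suc n x (∑resplitSuffix H) ⟨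
    ∑ (map (∑resplitSuffix H) (splits (suc n) x)) ∎
    where
    x₀ = x F.zero
    xs = splits n (tail x)
    H₀ : TripleFn
    H₀ K₁ P₁ = H (suc K₁) (x₀ V.∷ P₁)
    G : Split → B
    G (k , p , m , s) = H 0 V.[] (suc k) (x₀ V.∷ p) m s

  blockSum : Series → (l n : ℕ) → Vector B n → Map l → B
  blockSum h l n x Φ = ∑ (map Φ (blocks h l n x))

  blockSumStep : Series → (l : ℕ) → Map (suc l) → Split → B
  blockSumStep h l Φ (zero  , p , m , s) = 0#
  blockSumStep h l Φ (suc k , p , m , s) = blockSum h l m s (λ c → Φ (h (suc k) p V.∷ c))

  blockSum-suc : ∀ h l n x Φ → blockSum h (suc l) n x Φ ≈ ∑ (map (blockSumStep h l Φ) (splits n x))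
  blockSum-suc h l n x Φ = trans (∑map-concatMap Φ _ (splits n x)) (∑map-cong (splits n x) step)
    where
    step : ∀ e → _ ≈ blockSumStep h l Φ e
    step (zero  , p , m , s) = refl
    step (suc k , p , m , s) = reflexive (≡.cong ∑ (≡.sym (map-∘ (blocks h l m s))))

  blockSum-congᶠ : ∀ h l n x {Φ Ψ : Map l} → (∀ c → Φ c ≈ Ψ c) → blockSum h l n x Φ ≈ blockSum h l n x Ψ
  blockSum-congᶠ h l n x = ∑map-cong (blocks h l n x)

  blockSum-∑map : ∀ q l n (x : Vector B n) (F : Vector B l → X → B) xs →
    blockSum q l n x (λ d → ∑ (map (F d) xs)) ≈ ∑ (map (λ e → blockSum q l n x (λ d → F d e)) xs)
  blockSum-∑map q l n x F xs = ∑map-swap F (blocks q l n x) xs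

  mutual
    blockSum-congᵛ : ∀ h → Congruentˢ h → ∀ l n {x y} (Φ : Map l) → Congruentᵛ Φ → x ≈v y →
      blockSum h l n x Φ ≈ blockSum h l n y Φ
    blockSum-congᵛ h h-cong zero    zero    Φ Φ-cong x≈y = refl
    blockSum-congᵛ h h-cong zero    (suc n) Φ Φ-cong x≈y = refl
    blockSum-congᵛ h h-cong (suc l) n {x} {y} Φ Φ-cong x≈y = begin
      blockSum h (suc l) n x Φ                    ≈⟨ blockSum-suc h l n x Φ ⟩
      ∑ (map (blockSumStep h l Φ) (splits n x))
        ≈⟨ ∑splits-congᵛ n _ (blockSumStep-cong h h-cong l Φ Φ-cong) x≈y ⟩
      ∑ (map (blockSumStep h l Φ) (splits n y))   ≈⟨ blockSum-suc h l n y Φ ⟨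
      blockSum h (suc l) n y Φ                    ∎

    blockSumStep-cong : ∀ h → Congruentˢ h → ∀ l Φ → Congruentᵛ Φ → SplitCong (blockSumStep h l Φ)
    blockSumStep-cong h h-cong l Φ Φ-cong zero    p p' m s s' p≈p' s≈s' = refl
    blockSumStep-cong h h-cong l Φ Φ-cong (suc k) p p' m s s' p≈p' s≈s' =
      trans (blockSum-congᵛ h h-cong l m _ (Φ-cong ∘ ∷-cong refl) s≈s')
            (blockSum-congᶠ h l m s' (λ c → Φ-cong (∷-cong (h-cong (suc k) p≈p') ≈v-refl)))

  blockSum-vanish : ∀ h l n x Φ → n < l → blockSum h l n x Φ ≈ 0#
  blockSum-vanish h (suc l) n x Φ (s≤s n≤l) = begin
    blockSum h (suc l) n x Φ                   ≈⟨ blockSum-suc h l n x Φ ⟩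
    ∑ (map (blockSumStep h l Φ) (splits n x))  ≈⟨ ∑splits-cong n x _ (λ _ → 0#) step ⟩
    ∑ (map (λ _ → 0#) (splits n x))            ≈⟨ ∑map-zero (splits n x) (λ _ → refl) ⟩
    0#                                         ∎
    where
    step : ∀ k p m s → k +ℕ m ≡ n → blockSumStep h l Φ (k , p , m , s) ≈ 0#
    step zero    p m s k+m≡n = refl
    step (suc k) p m s k+m≡n =
      blockSum-vanish h l m s _ (ℕ.<-≤-trans (≡.subst (m <_) k+m≡n (s≤s (ℕ.m≤n+m m k))) n≤l)

  blockSum-one : ∀ h → Congruentˢ h → ∀ n x (Φ : Map 1) → Congruentᵛ Φ →
    blockSum h 1 (suc n) x Φ ≈ Φ (h (suc n) x V.∷ V.[])
  blockSum-one h h-cong n x Φ Φ-cong = trans (blockSum-suc h 0 (suc n) x Φ)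
    (trans (∑splits-last (suc n) x _ (blockSumStep-cong h h-cong 0 Φ Φ-cong) nonLast) (+-identityʳ _))
    where
    nonLast : ∀ k p m s → blockSumStep h 0 Φ (k , p , suc m , s) ≈ 0#
    nonLast zero    p m s = refl
    nonLast (suc k) p m s = refl

  blockSum-local : ∀ h h' N → (∀ j → j ≤ N → ∀ y → h j y ≈ h' j y) →
    ∀ l (x : Vector B N) (Φ : Map l) → Congruentᵛ Φ → blockSum h l N x Φ ≈ blockSum h' l N x Φ
  blockSum-local h h' zero    eq zero    x Φ Φ-cong = refl
  blockSum-local h h' (suc N) eq zero    x Φ Φ-cong = refl
  blockSum-local h h' N       eq (suc l) x Φ Φ-cong =
    trans (blockSum-suc h l N x Φ) (trans (∑splits-cong N x _ _ step) (sym (blockSum-suc h' l N x Φ)))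
    where
    step : ∀ k p m s → k +ℕ m ≡ N → blockSumStep h l Φ (k , p , m , s) ≈ blockSumStep h' l Φ (k , p , m , s)
    step zero    p m s k+m≡N = refl
    step (suc k) p m s k+m≡N = trans
      (blockSum-local h h' m (λ j j≤m → eq j (ℕ.≤-trans j≤m (≡.subst (m ≤_) k+m≡N (ℕ.m≤n+m m (suc k)))))
                      l s _ (Φ-cong ∘ ∷-cong refl))
      (blockSum-congᶠ h' l m s (λ c →
        Φ-cong (∷-cong (eq (suc k) (≡.subst (suc k ≤_) k+m≡N (ℕ.m≤m+n (suc k) m)) p) ≈v-refl)))

  -- with at least two blocks every block is shorter than x
  blockSum-local₂ : ∀ h h' n → (∀ j → j ≤ n → ∀ y → h j y ≈ h' j y) →
    ∀ l (x : Vector B (suc n)) (Φ : Map (suc (suc l))) → Congruentᵛ Φ →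
    blockSum h (suc (suc l)) (suc n) x Φ ≈ blockSum h' (suc (suc l)) (suc n) x Φ
  blockSum-local₂ h h' n eq l x Φ Φ-cong =
    trans (blockSum-suc h (suc l) (suc n) x Φ)
      (trans (∑splits-cong (suc n) x _ _ step) (sym (blockSum-suc h' (suc l) (suc n) x Φ)))
    where
    step : ∀ k p m s → k +ℕ m ≡ suc n →
      blockSumStep h (suc l) Φ (k , p , m , s) ≈ blockSumStep h' (suc l) Φ (k , p , m , s)
    step zero    p m       s k+m≡1+n = refl
    step (suc k) p zero    s k+m≡1+n = refl
    step (suc k) p (suc m) s k+m≡1+n = trans
      (blockSum-local h h' (suc m) (λ j j≤1+m → eq j (ℕ.≤-trans j≤1+m 1+m≤n)) (suc l) s _ (Φ-cong ∘ ∷-cong refl))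
      (blockSum-congᶠ h' (suc l) (suc m) s (λ c → Φ-cong (∷-cong (eq (suc k) 1+k≤n p) ≈v-refl)))
      where
      k+1+m≡n : k +ℕ suc m ≡ n
      k+1+m≡n = ℕ.suc-injective k+m≡1+n
      1+m≤n : suc m ≤ n
      1+m≤n = ≡.subst (suc m ≤_) k+1+m≡n (ℕ.m≤n+m (suc m) k)
      1+k≤n : suc k ≤ n
      1+k≤n = ≡.subst (suc k ≤_) (≡.trans (≡.sym (ℕ.+-suc k m)) k+1+m≡n) (s≤s (ℕ.m≤m+n k m))

  blockSum-congˢ : ∀ h h' → h ≋ h' → ∀ l n (x : Vector B n) (Φ : Map l) → Congruentᵛ Φ →
    blockSum h l n x Φ ≈ blockSum h' l n x Φ
  blockSum-congˢ h h' h≋h' l n = blockSum-local h h' n (λ j _ → h≋h' j) l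

  -- Multilinearity as preservation of linear relations

  record LinearRelation : Set (b ⊔ Level.suc ℓb) where
    field
      R        : B → B → B → Set ℓb
      R-resp-≈ : ∀ {a a' c c' d d'} → a ≈ a' → c ≈ c' → d ≈ d' → R a c d → R a' c' d'
      R-0      : R 0# 0# 0#
      R-+      : ∀ {a c d a' c' d'} → R a c d → R a' c' d' → R (a + a') (c + c') (d + d')
      R-neg    : ∀ {a c d} → R a c d → R (- a) (- c) (- d)
      R-*ʳ     : ∀ t {a c d} → R a c d → R (a * t) (c * t) (d * t)

  -- InSlot R x y z: x, y, z agree except in one slot, where their entries are R-related.
  -- Additivity, homogeneity and left B-linearity of a multilinear map are all preservation
  -- of such triples, for a ≈ c + d, a ≈ κ · c and a ≈ t * c respectively.
  data InSlot (R : B → B → B → Set ℓb) : ∀ {n} → Vector B n → Vector B n → Vector B n → Set (b ⊔ ℓb) where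
    here  : ∀ {n} {x y z : Vector B (suc n)} → R (x F.zero) (y F.zero) (z F.zero) →
            tail x ≈v tail y → tail x ≈v tail z → InSlot R x y z
    there : ∀ {n} {x y z : Vector B (suc n)} → x F.zero ≈ y F.zero → x F.zero ≈ z F.zero →
            InSlot R (tail x) (tail y) (tail z) → InSlot R x y z

  SlotPreserving : (B → B → B → Set ℓb) → ∀ {n} → Map n → Set (b ⊔ ℓb)
  SlotPreserving R Φ = ∀ {x y z} → InSlot R x y z → R (Φ x) (Φ y) (Φ z)

  HeadPreserving : (B → B → B → Set ℓb) → ∀ {n} → Map (suc n) → Set (b ⊔ ℓb)
  HeadPreserving R Φ = ∀ {x y z} → R (x F.zero) (y F.zero) (z F.zero) →
    tail x ≈v tail y → tail x ≈v tail z → R (Φ x) (Φ y) (Φ z)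

  module SlotPreservation (L : LinearRelation) where
    open LinearRelation L

    R-∑map : ∀ (xs : List X) (F₁ F₂ F₃ : X → B) → (∀ e → R (F₁ e) (F₂ e) (F₃ e)) →
      R (∑ (map F₁ xs)) (∑ (map F₂ xs)) (∑ (map F₃ xs))
    R-∑map []       F₁ F₂ F₃ r = R-0
    R-∑map (e ∷ xs) F₁ F₂ F₃ r = R-+ (r e) (R-∑map xs F₁ F₂ F₃ r)

    PrefixPreserving SuffixPreserving : (Split → B) → Set (b ⊔ ℓb)
    PrefixPreserving F = ∀ k p p' p'' m s s' s'' → InSlot R p p' p'' → s ≈v s' → s ≈v s'' →
      R (F (k , p , m , s)) (F (k , p' , m , s')) (F (k , p'' , m , s''))
    SuffixPreserving F = ∀ k p p' p'' m s s' s'' → p ≈v p' → p ≈v p'' → InSlot R s s' s'' →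
      R (F (k , p , m , s)) (F (k , p' , m , s')) (F (k , p'' , m , s''))

    ∑splits-preserving : ∀ {n} (F : Split → B) → SplitCong F → PrefixPreserving F → SuffixPreserving F →
      SlotPreserving R (λ (x : Vector B n) → ∑ (map F (splits n x)))
    ∑splits-preserving {suc n} F F-cong F-pre F-suf {x} {y} {z} slot =
      R-resp-≈ (sym (∑splits-suc n x F)) (sym (∑splits-suc n y F)) (sym (∑splits-suc n z F))
        (R-+ (F-suf 0 _ _ _ (suc n) x y z ([]≈v _ _) ([]≈v _ _) slot) (nonEmptyPrefix slot))
      where
      Fₐ : B → Split → B
      Fₐ a = F ∘ shiftSplit a
      nonEmptyPrefix : InSlot R x y z →
        R (∑ (map (Fₐ (x F.zero)) (splits n (tail x)))) (∑ (map (Fₐ (y F.zero)) (splits n (tail y))))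
          (∑ (map (Fₐ (z F.zero)) (splits n (tail z))))
      nonEmptyPrefix (here r x≈y x≈z) = R-resp-≈ refl
        (∑splits-congᵛ n _ (SplitCong-shift F-cong (y F.zero)) x≈y)
        (∑splits-congᵛ n _ (SplitCong-shift F-cong (z F.zero)) x≈z)
        (R-∑map (splits n (tail x)) _ _ _
          (λ (k , p , m , s) → F-pre (suc k) _ _ _ m s s s (here r ≈v-refl ≈v-refl) ≈v-refl ≈v-refl))
      nonEmptyPrefix (there x≈y x≈z slot') = R-resp-≈ refl
        (∑map-cong (splits n (tail y)) (λ (k , p , m , s) →
          F-cong (suc k) _ _ m s s (∷-cong x≈y ≈v-refl) ≈v-refl))
        (∑map-cong (splits n (tail z)) (λ (k , p , m , s) →
          F-cong (suc k) _ _ m s s (∷-cong x≈z ≈v-refl) ≈v-refl))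
        (∑splits-preserving (Fₐ (x F.zero)) (SplitCong-shift F-cong (x F.zero))
          (λ k p p' p'' m s s' s'' slotₚ s≈s' s≈s'' →
             F-pre (suc k) _ _ _ m s s' s'' (there refl refl slotₚ) s≈s' s≈s'')
          (λ k p p' p'' m s s' s'' p≈p' p≈p'' slotₛ →
             F-suf (suc k) _ _ _ m s s' s'' (∷-cong refl p≈p') (∷-cong refl p≈p'') slotₛ)
          slot')

    blockSum-preserving : ∀ h → Congruentˢ h → (∀ n → SlotPreserving R (h n)) →
      ∀ l n (Φ : Map l) → Congruentᵛ Φ → SlotPreserving R Φ →
      SlotPreserving R (λ (x : Vector B n) → blockSum h l n x Φ)
    blockSum-preserving h h-cong h-pres zero    (suc n) Φ Φ-cong Φ-pres slot = R-0
    blockSum-preserving h h-cong h-pres (suc l) n       Φ Φ-cong Φ-pres {x} {y} {z} slot =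
      R-resp-≈ (sym (blockSum-suc h l n x Φ)) (sym (blockSum-suc h l n y Φ)) (sym (blockSum-suc h l n z Φ))
        (∑splits-preserving (blockSumStep h l Φ) (blockSumStep-cong h h-cong l Φ Φ-cong) prefix suffix slot)
      where
      prefix : PrefixPreserving (blockSumStep h l Φ)
      prefix zero    p p' p'' m s s' s'' slotₚ s≈s' s≈s'' = R-0
      prefix (suc k) p p' p'' m s s' s'' slotₚ s≈s' s≈s'' =
        R-resp-≈ refl (blockSum-congᵛ h h-cong l m _ (Φ-cong ∘ ∷-cong refl) s≈s')
                      (blockSum-congᵛ h h-cong l m _ (Φ-cong ∘ ∷-cong refl) s≈s'')
          (R-∑map (blocks h l m s) _ _ _ (λ c → Φ-pres (here (h-pres (suc k) slotₚ) ≈v-refl ≈v-refl)))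
      suffix : SuffixPreserving (blockSumStep h l Φ)
      suffix zero    p p' p'' m s s' s'' p≈p' p≈p'' slotₛ = R-0
      suffix (suc k) p p' p'' m s s' s'' p≈p' p≈p'' slotₛ =
        R-resp-≈ refl (blockSum-congᶠ h l m s' (λ c → Φ-cong (∷-cong (h-cong (suc k) p≈p') ≈v-refl)))
                      (blockSum-congᶠ h l m s'' (λ c → Φ-cong (∷-cong (h-cong (suc k) p≈p'') ≈v-refl)))
          (blockSum-preserving h h-cong h-pres l m _ (Φ-cong ∘ ∷-cong refl) (Φ-pres ∘ there refl refl) slotₛ)

    blockSum-headPreserving : ∀ h → Congruentˢ h → (∀ n → HeadPreserving R (h (suc n))) →
      ∀ l n (Φ : Map (suc l)) → Congruentᵛ Φ → HeadPreserving R Φ →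
      HeadPreserving R (λ (x : Vector B (suc n)) → blockSum h (suc l) (suc n) x Φ)
    blockSum-headPreserving h h-cong h-pres l n Φ Φ-cong Φ-pres {x} {y} {z} r x≈y x≈z =
      R-resp-≈ (sym (unfold x ≈v-refl)) (sym (unfold y (≈v-sym x≈y))) (sym (unfold z (≈v-sym x≈z)))
        (R-+ R-0 (R-∑map (splits n (tail x)) _ _ _ (λ (k , p , m , s) →
          R-∑map (blocks h l m s) _ _ _ (λ c → Φ-pres (h-pres k r ≈v-refl ≈v-refl) ≈v-refl ≈v-refl))))
      where
      step = blockSumStep h l Φ
      unfold : ∀ w → tail w ≈v tail x → blockSum h (suc l) (suc n) w Φ ≈
        step (0 , V.[] , suc n , w) + ∑ (map (step ∘ shiftSplit (w F.zero)) (splits n (tail x)))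
      unfold w w≈x = trans (blockSum-suc h l (suc n) w Φ) (trans (∑splits-suc n w step)
        (+-congˡ (∑splits-congᵛ n _ (SplitCong-shift (blockSumStep-cong h h-cong l Φ Φ-cong) _) w≈x)))

    I-preserving : ∀ n → SlotPreserving R (I n)
    I-preserving (suc zero)    (here r _ _) = r
    I-preserving (suc zero)    (there _ _ ())
    I-preserving (suc (suc n)) slot = R-0

    I-headPreserving : ∀ n → HeadPreserving R (I (suc n))
    I-headPreserving zero    r _ _ = r
    I-headPreserving (suc n) r _ _ = R-0

    ⊚-preserving : ∀ g h → Congruentˢ g → Congruentˢ h →
      (∀ n → SlotPreserving R (g n)) → (∀ n → SlotPreserving R (h n)) → ∀ n → SlotPreserving R ((g ⊚ h) n)
    ⊚-preserving g h g-cong h-cong g-pres h-pres n {x} {y} {z} slot =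
      R-∑map (upTo (suc n)) (term x) (term y) (term z)
        (λ l → blockSum-preserving h h-cong h-pres l n (g l) (g-cong l) (g-pres l) slot)
      where
      term : Vector B n → ℕ → B
      term w l = blockSum h l n w (g l)

    ⊚-headPreserving : ∀ g h → Congruentˢ g → Congruentˢ h →
      (∀ n → HeadPreserving R (g (suc n))) → (∀ n → HeadPreserving R (h (suc n))) →
      ∀ n → HeadPreserving R ((g ⊚ h) (suc n))
    ⊚-headPreserving g h g-cong h-cong g-pres h-pres n {x} {y} {z} r x≈y x≈z =
      R-∑map (upTo (suc (suc n))) (term x) (term y) (term z) λ
        { zero    → R-0
        ; (suc l) → blockSum-headPreserving h h-cong h-pres l n (g (suc l)) (g-cong (suc l)) (g-pres l) {x} {y} {z}
                      r x≈y x≈z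
        }
      where
      term : Vector B (suc n) → ℕ → B
      term w l = blockSum h l (suc n) w (g l)

  IsSum : B → B → B → Set ℓb
  IsSum a c d = a ≈ c + d

  IsScaled : K.Carrier → B → B → B → Set ℓb
  IsScaled κ a c d = a ≈ (κ · c)

  IsLeftMultiple : B → B → B → B → Set ℓb
  IsLeftMultiple t a c d = a ≈ t * c

  ·-congˡ : ∀ κ {a a'} → a ≈ a' → (κ · a) ≈ (κ · a')
  ·-congˡ κ = *ₗ-cong K.refl

  ·-neg : ∀ κ a → (κ · (- a)) ≈ - (κ · a)
  ·-neg κ a = inverseˡ-unique _ _ (begin
    (κ · (- a)) + (κ · a) ≈⟨ *ₗ-distribˡ κ (- a) a ⟨
    κ · (- a + a)         ≈⟨ ·-congˡ κ (-‿inverseˡ a) ⟩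
    κ · 0#                ≈⟨ *ₗ-zeroʳ κ ⟩
    0#                    ∎)

  sumRelation : LinearRelation
  sumRelation = record
    { R        = IsSum
    ; R-resp-≈ = λ a≈a' c≈c' d≈d' r → trans (sym a≈a') (trans r (+-cong c≈c' d≈d'))
    ; R-0      = sym (+-identityˡ 0#)
    ; R-+      = λ r r' → trans (+-cong r r') (interchange _ _ _ _)
    ; R-neg    = λ r → trans (-‿cong r) (sym (⁻¹-∙-comm _ _))
    ; R-*ʳ     = λ t r → trans (*-congʳ r) (distribʳ t _ _)
    }

  scaledRelation : K.Carrier → LinearRelation
  scaledRelation κ = record
    { R        = IsScaled κ
    ; R-resp-≈ = λ a≈a' c≈c' d≈d' r → trans (sym a≈a') (trans r (·-congˡ κ c≈c'))
    ; R-0      = sym (*ₗ-zeroʳ κ)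
    ; R-+      = λ r r' → trans (+-cong r r') (sym (*ₗ-distribˡ κ _ _))
    ; R-neg    = λ r → trans (-‿cong r) (sym (·-neg κ _))
    ; R-*ʳ     = λ t r → trans (*-congʳ r) (·-*-assocˡ κ _ t)
    }

  leftMultipleRelation : B → LinearRelation
  leftMultipleRelation t = record
    { R        = IsLeftMultiple t
    ; R-resp-≈ = λ a≈a' c≈c' d≈d' r → trans (sym a≈a') (trans r (*-congˡ c≈c'))
    ; R-0      = sym (zeroʳ t)
    ; R-+      = λ r r' → trans (+-cong r r') (sym (distribˡ t _ _))
    ; R-neg    = λ r → trans (-‿cong r) (-‿distribʳ-* t _)
    ; R-*ʳ     = λ s r → trans (*-congʳ r) (*-assoc t _ s)
    }

  IsSum-*ˡ : ∀ t {a c d} → IsSum a c d → IsSum (t * a) (t * c) (t * d)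
  IsSum-*ˡ t r = trans (*-congˡ r) (distribˡ t _ _)

  IsScaled-*ˡ : ∀ κ t {a c d} → IsScaled κ a c d → IsScaled κ (t * a) (t * c) (t * d)
  IsScaled-*ˡ κ t r = trans (*-congˡ r) (·-*-assocʳ κ t _)

  _[_]≔_ : ∀ {n} → Vector B n → Fin n → B → Vector B n
  v [ i ]≔ a = updateAt v i (const a)

  []≔-cong : ∀ {n} (w : Vector B n) i {a a'} → a ≈ a' → (w [ i ]≔ a) ≈v (w [ i ]≔ a')
  []≔-cong w F.zero    a≈a' F.zero    = a≈a'
  []≔-cong w F.zero    a≈a' (F.suc j) = refl
  []≔-cong w (F.suc i) a≈a' F.zero    = refl
  []≔-cong w (F.suc i) a≈a' (F.suc j) = []≔-cong (tail w) i a≈a' j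

  []≔⇒InSlot : ∀ {R : B → B → B → Set ℓb} {n} (w : Vector B n) i {a c d} → R a c d →
    InSlot R (w [ i ]≔ a) (w [ i ]≔ c) (w [ i ]≔ d)
  []≔⇒InSlot {n = suc n} w F.zero    r = here r ≈v-refl ≈v-refl
  []≔⇒InSlot {n = suc n} w (F.suc i) r = there refl refl ([]≔⇒InSlot (tail w) i r)

  InSlot⇒[]≔ : ∀ {R n} {x y z : Vector B n} → InSlot R x y z →
    Σ (Fin n) λ i → Σ (Vector B n) λ w → Σ B λ a → Σ B λ c → Σ B λ d →
      R a c d × (x ≈v (w [ i ]≔ a)) × (y ≈v (w [ i ]≔ c)) × (z ≈v (w [ i ]≔ d))
  InSlot⇒[]≔ {x = x} {y} {z} (here r x≈y x≈z) = F.zero , x , _ , _ , _ , r , onX , onY , onZ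
    where
    onX : x ≈v (x [ F.zero ]≔ x F.zero)
    onX F.zero    = refl
    onX (F.suc j) = refl
    onY : y ≈v (x [ F.zero ]≔ y F.zero)
    onY F.zero    = refl
    onY (F.suc j) = sym (x≈y j)
    onZ : z ≈v (x [ F.zero ]≔ z F.zero)
    onZ F.zero    = refl
    onZ (F.suc j) = sym (x≈z j)
  InSlot⇒[]≔ {x = x} {y} {z} (there x≈y x≈z slot) with InSlot⇒[]≔ slot
  ... | i , w , a , c , d , r , tx , ty , tz = F.suc i , x F.zero V.∷ w , a , c , d , r , onX , onY , onZ
    where
    onX : x ≈v ((x F.zero V.∷ w) [ F.suc i ]≔ a)
    onX F.zero    = refl
    onX (F.suc j) = tx j
    onY : y ≈v ((x F.zero V.∷ w) [ F.suc i ]≔ c)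
    onY F.zero    = sym x≈y
    onY (F.suc j) = ty j
    onZ : z ≈v ((x F.zero V.∷ w) [ F.suc i ]≔ d)
    onZ F.zero    = sym x≈z
    onZ (F.suc j) = tz j

  multilinear⇒congruent : ∀ {n} {f : Map n} → Multilinear f → Congruentᵛ f
  multilinear⇒congruent f-ml {x} {y} = Multilinear.cong f-ml x y

  multilinear⇒additive : ∀ {n} {f : Map n} → Multilinear f → SlotPreserving IsSum f
  multilinear⇒additive f-ml slot with InSlot⇒[]≔ slot
  ... | i , w , a , c , d , r , tx , ty , tz =
    trans (multilinear⇒congruent f-ml (≈v-trans tx ([]≔-cong w i r)))
      (trans (Multilinear.additive f-ml w i c d)
             (sym (+-cong (multilinear⇒congruent f-ml ty) (multilinear⇒congruent f-ml tz))))

  multilinear⇒homogeneous : ∀ {n} {f : Map n} → Multilinear f → ∀ κ → SlotPreserving (IsScaled κ) f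
  multilinear⇒homogeneous f-ml κ slot with InSlot⇒[]≔ slot
  ... | i , w , a , c , d , r , tx , ty , tz =
    trans (multilinear⇒congruent f-ml (≈v-trans tx ([]≔-cong w i r)))
      (trans (Multilinear.homogeneous f-ml w i κ c) (·-congˡ κ (sym (multilinear⇒congruent f-ml ty))))

  slotwise⇒multilinear : ∀ {n} {f : Map n} → Congruentᵛ f → SlotPreserving IsSum f →
    (∀ κ → SlotPreserving (IsScaled κ) f) → Multilinear f
  slotwise⇒multilinear f-cong f-add f-hom = record
    { cong        = λ v w → f-cong
    ; additive    = λ v i x y → f-add ([]≔⇒InSlot v i refl)
    ; homogeneous = λ v i κ x → f-hom κ ([]≔⇒InSlot {R = IsScaled κ} v i {d = x} refl)
    }

  I⋆-zero : ∀ f (x : Vector B 0) → (I ⋆ f) 0 x ≈ 0#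
  I⋆-zero f x = trans (+-identityʳ _) (zeroˡ _)

  I⋆-suc : ∀ f n (x : Vector B (suc n)) → (I ⋆ f) (suc n) x ≈ x F.zero * f n (tail x)
  I⋆-suc f n x = begin
    (I ⋆ f) (suc n) x
      ≈⟨ ∑splits-suc n x term ⟩
    term (0 , V.[] , suc n , x) + ∑ (map (term ∘ shiftSplit (x F.zero)) (splits n (tail x)))
      ≈⟨ +-cong (zeroˡ _) (onlyFirstBlock n (tail x)) ⟩
    0# + x F.zero * f n (tail x)
      ≈⟨ +-identityˡ _ ⟩
    x F.zero * f n (tail x) ∎
    where
    term : Split → B
    term (k , p , m , s) = I k p * f m s
    onlyFirstBlock : ∀ n (y : Vector B n) →
      ∑ (map (term ∘ shiftSplit (x F.zero)) (splits n y)) ≈ x F.zero * f n y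
    onlyFirstBlock zero    y = +-identityʳ _
    onlyFirstBlock (suc n) y = trans (∑splits-suc n y _)
      (trans (+-congˡ (∑map-zero (splits n (tail y)) (λ _ → zeroˡ _))) (+-identityʳ _))

  -- I · f for some f ∈ Mult[[B]], described without f; f_n is recovered as g_{n+1}(1, -)
  record IsIMult (g : Series) : Set (k ⊔ b ⊔ ℓb) where
    field
      congruent   : Congruentˢ g
      additive    : ∀ n → SlotPreserving IsSum (g n)
      homogeneous : ∀ κ n → SlotPreserving (IsScaled κ) (g n)
      leftLinear  : ∀ t n → HeadPreserving (IsLeftMultiple t) (g (suc n))
      vanish₀     : ∀ x → g 0 x ≈ 0#

    multilinear : IsMult g
    multilinear n = slotwise⇒multilinear (congruent n) (additive n) (λ κ → homogeneous κ n)

  GI⇒IsIMult : ∀ g → GI g → IsIMult g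
  GI⇒IsIMult g (f , (f-mult , _) , g≋I⋆f) = record
    { congruent   = g-cong
    ; additive    = slot sumRelation IsSum-*ˡ (λ n → multilinear⇒additive (f-mult n))
    ; homogeneous = λ κ → slot (scaledRelation κ) (IsScaled-*ˡ κ) (λ n → multilinear⇒homogeneous (f-mult n) κ)
    ; leftLinear  = λ t n {x} {y} {z} → head (leftMultipleRelation t) n {x} {y} {z}
    ; vanish₀     = λ x → trans (g≋I⋆f 0 x) (I⋆-zero f x)
    }
    where
    f-cong : Congruentˢ f
    f-cong n = multilinear⇒congruent (f-mult n)
    g-suc : ∀ n x → g (suc n) x ≈ x F.zero * f n (tail x)
    g-suc n x = trans (g≋I⋆f (suc n) x) (I⋆-suc f n x)
    g-cong : Congruentˢ g
    g-cong zero    {x} {y} x≈y = trans (g≋I⋆f 0 x) (trans (I⋆-zero f x) (sym (trans (g≋I⋆f 0 y) (I⋆-zero f y))))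
    g-cong (suc n) {x} {y} x≈y =
      trans (g-suc n x) (trans (*-cong (x≈y F.zero) (f-cong n (x≈y ∘ F.suc))) (sym (g-suc n y)))
    module _ (L : LinearRelation) where
      open LinearRelation L
      head : ∀ n → HeadPreserving R (g (suc n))
      head n {x} {y} {z} r x≈y x≈z = R-resp-≈ (sym (g-suc n x)) (sym (g-suc n y)) (sym (g-suc n z))
        (R-resp-≈ refl (*-congˡ (f-cong n x≈y)) (*-congˡ (f-cong n x≈z)) (R-*ʳ _ r))
      slot : (∀ t {a c d} → R a c d → R (t * a) (t * c) (t * d)) → (∀ n → SlotPreserving R (f n)) →
        ∀ n → SlotPreserving R (g n)
      slot R-*ˡ f-pres (suc n) (here r x≈y x≈z) = head n r x≈y x≈z
      slot R-*ˡ f-pres (suc n) {x} {y} {z} (there x≈y x≈z slot') =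
        R-resp-≈ (sym (g-suc n x)) (sym (g-suc n y)) (sym (g-suc n z))
          (R-resp-≈ refl (*-congʳ x≈y) (*-congʳ x≈z) (R-*ˡ (x F.zero) (f-pres n slot')))

  GI⇒linearTerm : ∀ g → GI g → Σ B λ u → IsUnit u × (∀ y → g 1 y ≈ y F.zero * u)
  GI⇒linearTerm g (f , (f-mult , f₀-unit) , g≋I⋆f) = f 0 V.[] , f₀-unit , λ y →
    trans (g≋I⋆f 1 y) (trans (I⋆-suc f 0 y) (*-congˡ (multilinear⇒congruent (f-mult 0) ([]≈v _ _))))

  IsIMult⇒GI : ∀ g → IsIMult g → IsUnit (g 1 (1# V.∷ V.[])) → GI g
  IsIMult⇒GI g g-IM unit = f , (f-mult , unit) , g≋I⋆f
    where
    open IsIMult g-IM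
    f : Series
    f m y = g (suc m) (1# V.∷ y)
    f-mult : IsMult f
    f-mult m = slotwise⇒multilinear (congruent (suc m) ∘ ∷-cong refl)
      (λ {x} {y} {z} → additive (suc m) {1# V.∷ x} {1# V.∷ y} {1# V.∷ z} ∘ there refl refl)
      (λ κ {x} {y} {z} → homogeneous κ (suc m) {1# V.∷ x} {1# V.∷ y} {1# V.∷ z} ∘ there refl refl)
    g≋I⋆f : g ≋ (I ⋆ f)
    g≋I⋆f zero    x = trans (vanish₀ x) (sym (I⋆-zero f x))
    g≋I⋆f (suc m) x = trans (leftLinear (x F.zero) m {x} {1# V.∷ tail x} {1# V.∷ tail x}
                               (sym (*-identityʳ _)) ≈v-refl ≈v-refl)
                            (sym (I⋆-suc f m x))

  -- Associativity and units of composition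

  PairFn : Set b
  PairFn = (L₁ : ℕ) → Vector B L₁ → (L₂ : ℕ) → Vector B L₂ → B

  onSplit : PairFn → Split → B
  onSplit G (L₁ , c , L₂ , d) = G L₁ c L₂ d

  consFirst : PairFn → B → PairFn
  consFirst G a L₁ c = G (suc L₁) (a V.∷ c)

  splitSum : PairFn → (L : ℕ) → Vector B L → B
  splitSum G L d = ∑ (map (onSplit G) (splits L d))

  module BlocksOfSplits (q : Series) where

    blockParts : PairFn → Split → B
    blockParts G (K , P , M , S) =
      ∑< (suc K) (λ L₁ → blockSum q L₁ K P (λ c → ∑< (suc M) (λ L₂ → blockSum q L₂ M S (G L₁ c L₂))))

    splitBlocks : ∀ n → Vector B n → PairFn → B
    splitBlocks n x G = ∑< (suc n) (λ L → blockSum q L n x (splitSum G L))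

    firstBlockThenParts : PairFn → TripleFn
    firstBlockThenParts G zero     P₁ K₂ P₂ M S = 0#
    firstBlockThenParts G (suc K₁) P₁ K₂ P₂ M S = blockParts (consFirst G (q (suc K₁) P₁)) (K₂ , P₂ , M , S)

    splitAfterFirstBlock : PairFn → ℕ → Split → B
    splitAfterFirstBlock G L (zero   , p  , m  , s)  = 0#
    splitAfterFirstBlock G L (suc K₁ , P₁ , M₁ , S₁) = blockSum q L M₁ S₁ (splitSum (consFirst G (q (suc K₁) P₁)) L)

    dropEmptyPrefix-blockParts : ∀ G e →
      dropEmptyPrefix (blockParts G) e ≈ ∑resplitPrefix (firstBlockThenParts G) e
    dropEmptyPrefix-blockParts G (zero , P , M , S) = sym (+-identityˡ 0#)
    dropEmptyPrefix-blockParts G (suc K , P , M , S) = begin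
      blockParts G (suc K , P , M , S)
        ≈⟨ trans (∑<-suc (suc K) _) (+-identityˡ _) ⟩
      ∑< (suc K) (λ l → blockSum q (suc l) (suc K) P (inner (suc l)))
        ≈⟨ ∑map-cong (upTo (suc K)) (λ l → blockSum-suc q l (suc K) P (inner (suc l))) ⟩
      ∑< (suc K) (λ l → ∑ (map (blockSumStep q l (inner (suc l))) (splits (suc K) P)))
        ≈⟨ ∑map-swap (λ l → blockSumStep q l (inner (suc l))) (upTo (suc K)) (splits (suc K) P) ⟩
      ∑ (map (λ e → ∑< (suc K) (λ l → blockSumStep q l (inner (suc l)) e)) (splits (suc K) P))
        ≈⟨ ∑splits-cong (suc K) P _ _ firstPart ⟩
      ∑ (map (resplitPrefix (firstBlockThenParts G) M S) (splits (suc K) P)) ∎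
      where
      inner : (L₁ : ℕ) → Vector B L₁ → B
      inner L₁ c = ∑< (suc M) (λ L₂ → blockSum q L₂ M S (G L₁ c L₂))
      firstPart : ∀ k p m s → k +ℕ m ≡ suc K →
        ∑< (suc K) (λ l → blockSumStep q l (inner (suc l)) (k , p , m , s))
          ≈ resplitPrefix (firstBlockThenParts G) M S (k , p , m , s)
      firstPart zero    p m s k+m≡1+K = ∑<-zero (suc K) (λ _ → refl)
      firstPart (suc k) p m s k+m≡1+K = sym (∑<-extend (suc m) (suc K) _
        (s≤s (≡.subst (m ≤_) (ℕ.suc-injective k+m≡1+K) (ℕ.m≤n+m m k)))
        (λ i m<i → blockSum-vanish q i m s _ m<i))

    blockSum-splitSum-suc : ∀ G n x L → blockSum q (suc L) n x (splitSum G (suc L)) ≈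
      blockSum q (suc L) n x (G 0 V.[] (suc L)) + ∑ (map (splitAfterFirstBlock G L) (splits n x))
    blockSum-splitSum-suc G n x L = begin
      blockSum q (suc L) n x (splitSum G (suc L))
        ≈⟨ blockSum-suc q L n x _ ⟩
      ∑ (map (blockSumStep q L (splitSum G (suc L))) (splits n x))
        ≈⟨ ∑map-cong (splits n x) emptyOrNot ⟩
      ∑ (map (λ e → blockSumStep q L (G 0 V.[] (suc L)) e + splitAfterFirstBlock G L e) (splits n x))
        ≈⟨ ∑map-+ _ _ (splits n x) ⟩
      ∑ (map (blockSumStep q L (G 0 V.[] (suc L))) (splits n x)) + ∑ (map (splitAfterFirstBlock G L) (splits n x))
        ≈⟨ +-congʳ (blockSum-suc q L n x _) ⟨
      blockSum q (suc L) n x (G 0 V.[] (suc L)) + ∑ (map (splitAfterFirstBlock G L) (splits n x)) ∎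
      where
      emptyOrNot : ∀ e → blockSumStep q L (splitSum G (suc L)) e ≈
        blockSumStep q L (G 0 V.[] (suc L)) e + splitAfterFirstBlock G L e
      emptyOrNot (zero , p , m , s) = sym (+-identityˡ 0#)
      emptyOrNot (suc K₁ , P₁ , M₁ , S₁) = trans
        (blockSum-congᶠ q L M₁ S₁ (λ c → trans (∑splits-suc L _ (onSplit G))
          (+-congˡ (∑map-cong (splits L c) (λ (k , p , m , s) → refl)))))
        (∑map-+ _ _ (blocks q L M₁ S₁))

    emptyFirstPart : ∀ G n x →
      blockSum q 0 n x (splitSum G 0) + ∑< n (λ L → blockSum q (suc L) n x (G 0 V.[] (suc L)))
        ≈ blockParts G (0 , V.[] , n , x)
    emptyFirstPart G n x = begin
      blockSum q 0 n x (splitSum G 0) + ∑< n (λ L → blockSum q (suc L) n x (G 0 V.[] (suc L)))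
        ≈⟨ +-congʳ (blockSum-congᶠ q 0 n x (λ c → +-identityʳ _)) ⟩
      blockSum q 0 n x (G 0 V.[] 0) + ∑< n (λ L → blockSum q (suc L) n x (G 0 V.[] (suc L)))
        ≈⟨ ∑<-suc n _ ⟨
      ∑< (suc n) (λ L₂ → blockSum q L₂ n x (G 0 V.[] L₂))
        ≈⟨ trans (+-identityʳ _) (+-identityʳ _) ⟨
      blockParts G (0 , V.[] , n , x) ∎

    SplitBlocks≈∑BlockParts : ℕ → Set (b ⊔ ℓb)
    SplitBlocks≈∑BlockParts n = ∀ (x : Vector B n) G → splitBlocks n x G ≈ ∑ (map (blockParts G) (splits n x))

    ∑<-∑splitAfterFirstBlock : ∀ n → (∀ {m} → m < n → SplitBlocks≈∑BlockParts m) → ∀ (x : Vector B n) G →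
      ∑< n (λ L → ∑ (map (splitAfterFirstBlock G L) (splits n x)))
        ≈ ∑ (map (∑resplitSuffix (firstBlockThenParts G)) (splits n x))
    ∑<-∑splitAfterFirstBlock n IH x G = begin
      ∑< n (λ L → ∑ (map (splitAfterFirstBlock G L) (splits n x)))
        ≈⟨ ∑map-swap (splitAfterFirstBlock G) (upTo n) (splits n x) ⟩
      ∑ (map (λ e → ∑< n (λ L → splitAfterFirstBlock G L e)) (splits n x))
        ≈⟨ ∑splits-cong n x _ _ split ⟩
      ∑ (map (∑resplitSuffix (firstBlockThenParts G)) (splits n x)) ∎
      where
      split : ∀ k p m s → k +ℕ m ≡ n →
        ∑< n (λ L → splitAfterFirstBlock G L (k , p , m , s))
          ≈ ∑resplitSuffix (firstBlockThenParts G) (k , p , m , s)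
      split zero    p m s k+m≡n = trans (∑<-zero n (λ _ → refl)) (sym (∑map-zero (splits m s) (λ _ → refl)))
      split (suc k) p m s k+m≡n = begin
        ∑< n (λ L → splitAfterFirstBlock G L (suc k , p , m , s))
          ≈⟨ ∑<-extend (suc m) n _ m<n (λ i m<i → blockSum-vanish q i m s _ m<i) ⟨
        splitBlocks m s (consFirst G (q (suc k) p))
          ≈⟨ IH m<n s _ ⟩
        ∑ (map (blockParts (consFirst G (q (suc k) p))) (splits m s))
          ≈⟨ ∑map-cong (splits m s) (λ (k , p , m , s) → refl) ⟩
        ∑resplitSuffix (firstBlockThenParts G) (suc k , p , m , s) ∎
        where
        m<n : m < n
        m<n = ≡.subst (m <_) k+m≡n (s≤s (ℕ.m≤n+m m k))

    splitBlocks≈∑blockParts : ∀ n → SplitBlocks≈∑BlockParts n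
    splitBlocks≈∑blockParts = <-rec SplitBlocks≈∑BlockParts λ n IH x G → begin
      splitBlocks n x G
        ≈⟨ ∑<-suc n _ ⟩
      blockSum q 0 n x (splitSum G 0) + ∑< n (λ L → blockSum q (suc L) n x (splitSum G (suc L)))
        ≈⟨ +-congˡ (∑map-cong (upTo n) (blockSum-splitSum-suc G n x)) ⟩
      blockSum q 0 n x (splitSum G 0) + ∑< n (λ L → blockSum q (suc L) n x (G 0 V.[] (suc L))
                                                    + ∑ (map (splitAfterFirstBlock G L) (splits n x)))
        ≈⟨ +-congˡ (∑map-+ _ _ (upTo n)) ⟩
      blockSum q 0 n x (splitSum G 0) + (∑< n (λ L → blockSum q (suc L) n x (G 0 V.[] (suc L)))
                                          + ∑< n (λ L → ∑ (map (splitAfterFirstBlock G L) (splits n x))))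
        ≈⟨ +-assoc _ _ _ ⟨
      (blockSum q 0 n x (splitSum G 0) + ∑< n (λ L → blockSum q (suc L) n x (G 0 V.[] (suc L))))
        + ∑< n (λ L → ∑ (map (splitAfterFirstBlock G L) (splits n x)))
        ≈⟨ +-cong (emptyFirstPart G n x) (∑<-∑splitAfterFirstBlock n IH x G) ⟩
      blockParts G (0 , V.[] , n , x) + ∑ (map (∑resplitSuffix (firstBlockThenParts G)) (splits n x))
        ≈⟨ +-congˡ (∑splits-assoc n x (firstBlockThenParts G)) ⟨
      blockParts G (0 , V.[] , n , x) + ∑ (map (∑resplitPrefix (firstBlockThenParts G)) (splits n x))
        ≈⟨ +-congˡ (∑map-cong (splits n x) (dropEmptyPrefix-blockParts G)) ⟨
      blockParts G (0 , V.[] , n , x) + ∑ (map (dropEmptyPrefix (blockParts G)) (splits n x))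
        ≈⟨ ∑splits-peel n x (blockParts G) ⟨
      ∑ (map (blockParts G) (splits n x)) ∎

  additive-head-0# : ∀ {j} (Φ : Map (suc j)) → SlotPreserving IsSum Φ → ∀ c → Φ (0# V.∷ c) ≈ 0#
  additive-head-0# Φ Φ-add c =
    identityʳ-unique _ _ (sym (Φ-add {0# V.∷ c} (here (sym (+-identityˡ 0#)) ≈v-refl ≈v-refl)))

  additive-head-∑map : ∀ {j} (Φ : Map (suc j)) → SlotPreserving IsSum Φ →
    ∀ c (F : X → B) xs → Φ (∑ (map F xs) V.∷ c) ≈ ∑ (map (λ e → Φ (F e V.∷ c)) xs)
  additive-head-∑map Φ Φ-add c = additive-∑map (λ t → Φ (t V.∷ c))
    (additive-head-0# Φ Φ-add c) (λ u v → Φ-add (here refl ≈v-refl ≈v-refl))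

  additive-head-∑<-blockSum : ∀ {j} (Φ : Map (suc j)) → SlotPreserving IsSum Φ →
    ∀ c q m (P : Vector B m) N (F : (L : ℕ) → Map L) →
    Φ (∑< N (λ L → blockSum q L m P (F L)) V.∷ c) ≈ ∑< N (λ L → blockSum q L m P (λ b → Φ (F L b V.∷ c)))
  additive-head-∑<-blockSum Φ Φ-add c q m P N F =
    trans (additive-head-∑map Φ Φ-add c _ (upTo N))
          (∑map-cong (upTo N) (λ L → additive-head-∑map Φ Φ-add c (F L) (blocks q L m P)))

  blockSum-∑<-blockSum : ∀ r l n (x : Vector B n) q m (P : Vector B m) N
    (F : Vector B l → (L : ℕ) → Vector B L → B) →
    blockSum r l n x (λ d → ∑< N (λ L → blockSum q L m P (F d L)))
      ≈ ∑< N (λ L → blockSum q L m P (λ b → blockSum r l n x (λ d → F d L b)))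
  blockSum-∑<-blockSum r l n x q m P N F =
    trans (blockSum-∑map r l n x _ (upTo N))
          (∑map-cong (upTo N) (λ L → blockSum-∑map r l n x _ (blocks q L m P)))

  module _ (h q : Series) where
    open BlocksOfSplits q

    BlockSum-⊚ : ℕ → Set (b ⊔ ℓb)
    BlockSum-⊚ j = ∀ n x (Φ : Map j) → Congruentᵛ Φ → SlotPreserving IsSum Φ →
      blockSum (h ⊚ q) j n x Φ ≈ ∑< (suc n) (λ L → blockSum q L n x (λ d → blockSum h j L d Φ))

    stepPair : ∀ {j} → Map (suc j) → PairFn
    stepPair {j} Φ L₁ b L₂ d = blockSumStep h j Φ (L₁ , b , L₂ , d)

    blockSumStep-⊚ : ∀ j → BlockSum-⊚ j → ∀ Φ → Congruentᵛ Φ → SlotPreserving IsSum Φ →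
      ∀ e → blockSumStep (h ⊚ q) j Φ e ≈ blockParts (stepPair Φ) e
    blockSumStep-⊚ j IH Φ Φ-cong Φ-add (zero , P , M , S) = sym (trans (+-identityʳ _) (trans (+-identityʳ _)
      (∑<-zero (suc M) (λ L₂ → ∑map-zero (blocks q L₂ M S) (λ _ → refl)))))
    blockSumStep-⊚ j IH Φ Φ-cong Φ-add (suc K , P , M , S) = begin
      blockSum (h ⊚ q) j M S (λ c → Φ ((h ⊚ q) (suc K) P V.∷ c))
        ≈⟨ IH M S _ (Φ-cong ∘ ∷-cong refl) (Φ-add ∘ there refl refl) ⟩
      ∑< (suc M) (λ L → blockSum q L M S (λ d → blockSum h j L d (λ c → Φ ((h ⊚ q) (suc K) P V.∷ c))))
        ≈⟨ ∑map-cong (upTo (suc M)) (λ L → blockSum-congᶠ q L M S (λ d → blockSum-congᶠ h j L d (λ c →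
             additive-head-∑<-blockSum Φ Φ-add c q (suc K) P (suc (suc K)) h))) ⟩
      ∑< (suc M) (λ L → blockSum q L M S (λ d → blockSum h j L d (λ c →
        ∑< (suc (suc K)) (λ L₁ → blockSum q L₁ (suc K) P (λ b → Φ (h L₁ b V.∷ c))))))
        ≈⟨ ∑map-cong (upTo (suc M)) (λ L → trans
             (blockSum-congᶠ q L M S (λ d → blockSum-∑<-blockSum h j L d q (suc K) P (suc (suc K)) _))
             (blockSum-∑<-blockSum q L M S q (suc K) P (suc (suc K)) _)) ⟩
      ∑< (suc M) (λ L → ∑< (suc (suc K)) (λ L₁ →
        blockSum q L₁ (suc K) P (λ b → blockSum q L M S (firstBlock L₁ b L))))
        ≈⟨ ∑map-swap _ (upTo (suc M)) (upTo (suc (suc K))) ⟩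
      ∑< (suc (suc K)) (λ L₁ → ∑< (suc M) (λ L →
        blockSum q L₁ (suc K) P (λ b → blockSum q L M S (firstBlock L₁ b L))))
        ≈⟨ ∑map-cong (upTo (suc (suc K))) (λ L₁ →
             trans (sym (blockSum-∑map q L₁ (suc K) P _ (upTo (suc M)))) (nonEmptyFirstBlock L₁)) ⟩
      blockParts (stepPair Φ) (suc K , P , M , S) ∎
      where
      firstBlock : PairFn
      firstBlock L₁ b L d = blockSum h j L d (λ c → Φ (h L₁ b V.∷ c))
      nonEmptyFirstBlock : ∀ L₁ →
        blockSum q L₁ (suc K) P (λ b → ∑< (suc M) (λ L → blockSum q L M S (firstBlock L₁ b L)))
          ≈ blockSum q L₁ (suc K) P (λ b → ∑< (suc M) (λ L → blockSum q L M S (stepPair Φ L₁ b L)))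
      nonEmptyFirstBlock zero     = refl
      nonEmptyFirstBlock (suc L₁) = refl

    blockSum-⊚ : ∀ j → BlockSum-⊚ j
    blockSum-⊚ zero zero    x Φ Φ-cong Φ-add = sym (trans (+-identityʳ _) (+-identityʳ _))
    blockSum-⊚ zero (suc n) x Φ Φ-cong Φ-add = sym (∑<-zero (suc (suc n)) noBlocks)
      where
      noBlocks : ∀ L → blockSum q L (suc n) x (λ d → blockSum h 0 L d Φ) ≈ 0#
      noBlocks zero    = refl
      noBlocks (suc L) = ∑map-zero (blocks q (suc L) (suc n) x) (λ _ → refl)
    blockSum-⊚ (suc j) n x Φ Φ-cong Φ-add = begin
      blockSum (h ⊚ q) (suc j) n x Φ
        ≈⟨ blockSum-suc (h ⊚ q) j n x Φ ⟩
      ∑ (map (blockSumStep (h ⊚ q) j Φ) (splits n x))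
        ≈⟨ ∑map-cong (splits n x) (blockSumStep-⊚ j (blockSum-⊚ j) Φ Φ-cong Φ-add) ⟩
      ∑ (map (blockParts (stepPair Φ)) (splits n x))
        ≈⟨ splitBlocks≈∑blockParts n x (stepPair Φ) ⟨
      splitBlocks n x (stepPair Φ)
        ≈⟨ ∑map-cong (upTo (suc n)) (λ L → blockSum-congᶠ q L n x (λ d →
             trans (∑map-cong (splits L d) (λ _ → refl)) (sym (blockSum-suc h j L d Φ)))) ⟩
      ∑< (suc n) (λ L → blockSum q L n x (λ d → blockSum h (suc j) L d Φ)) ∎

  ⊚-assoc : ∀ g h q → (∀ j → Congruentᵛ (g j)) → (∀ j → SlotPreserving IsSum (g j)) →
    ((g ⊚ h) ⊚ q) ≋ (g ⊚ (h ⊚ q))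
  ⊚-assoc g h q g-cong g-add n x = sym (begin
    (g ⊚ (h ⊚ q)) n x
      ≈⟨ ∑map-cong (upTo (suc n)) (λ j → blockSum-⊚ h q j n x (g j) (g-cong j) (g-add j)) ⟩
    ∑< (suc n) (λ j → ∑< (suc n) (λ L → blockSum q L n x (λ d → blockSum h j L d (g j))))
      ≈⟨ ∑map-swap (λ j L → blockSum q L n x (λ d → blockSum h j L d (g j))) (upTo (suc n)) (upTo (suc n)) ⟩
    ∑< (suc n) (λ L → ∑< (suc n) (λ j → blockSum q L n x (λ d → blockSum h j L d (g j))))
      ≈⟨ ∑map-cong (upTo (suc n)) (λ L → sym (blockSum-∑map q L n x _ (upTo (suc n)))) ⟩
    ∑< (suc n) (λ L → blockSum q L n x (λ d → ∑< (suc n) (λ j → blockSum h j L d (g j))))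
      ≈⟨ ∑<-cong (suc n) (λ L L<1+n → blockSum-congᶠ q L n x (λ d → sym (∑<-extend (suc L) (suc n) _ L<1+n
           (λ i L<i → blockSum-vanish h i L d (g i) L<i)))) ⟩
    ((g ⊚ h) ⊚ q) n x ∎)

  ⊚-congˡ : ∀ g g' q → g ≋ g' → (g ⊚ q) ≋ (g' ⊚ q)
  ⊚-congˡ g g' q g≋g' n x = ∑map-cong (upTo (suc n)) (λ l → blockSum-congᶠ q l n x (g≋g' l))

  ⊚-congʳ : ∀ g h h' → Congruentˢ g → h ≋ h' → (g ⊚ h) ≋ (g ⊚ h')
  ⊚-congʳ g h h' g-cong h≋h' n x =
    ∑map-cong (upTo (suc n)) (λ l → blockSum-congˢ h h' h≋h' l n x (g l) (g-cong l))

  blockSum-I-suc : ∀ l n (x : Vector B (suc n)) (Φ : Map (suc l)) → SlotPreserving IsSum Φ →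
    blockSum I (suc l) (suc n) x Φ ≈ blockSum I l n (tail x) (λ c → Φ (x F.zero V.∷ c))
  blockSum-I-suc l n x Φ Φ-add = trans (blockSum-suc I l (suc n) x Φ) (trans (∑splits-suc n x _)
    (trans (+-identityˡ _) (∑splits-first n (tail x) _ (λ k p m s →
      ∑map-zero (blocks I l m s) (additive-head-0# Φ Φ-add)))))

  blockSum-I-diag : ∀ n (x : Vector B n) (Φ : Map n) → Congruentᵛ Φ → SlotPreserving IsSum Φ →
    blockSum I n n x Φ ≈ Φ x
  blockSum-I-diag zero    x Φ Φ-cong Φ-add = trans (+-identityʳ _) (Φ-cong ([]≈v _ _))
  blockSum-I-diag (suc n) x Φ Φ-cong Φ-add = trans (blockSum-I-suc n n x Φ Φ-add)
    (trans (blockSum-I-diag n (tail x) _ (Φ-cong ∘ ∷-cong refl) (Φ-add ∘ there refl refl)) (Φ-cong (head∷tail≈v x)))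

  blockSum-I-off : ∀ l n (x : Vector B n) (Φ : Map l) → SlotPreserving IsSum Φ → ¬ (l ≡ n) →
    blockSum I l n x Φ ≈ 0#
  blockSum-I-off zero    zero    x Φ Φ-add l≢n = ⊥-elim (l≢n ≡.refl)
  blockSum-I-off zero    (suc n) x Φ Φ-add l≢n = refl
  blockSum-I-off (suc l) zero    x Φ Φ-add l≢n = refl
  blockSum-I-off (suc l) (suc n) x Φ Φ-add l≢n = trans (blockSum-I-suc l n x Φ Φ-add)
    (blockSum-I-off l n (tail x) _ (Φ-add ∘ there refl refl) (l≢n ∘ ≡.cong suc))

  ⊚-identityʳ : ∀ g → (∀ j → Congruentᵛ (g j)) → (∀ j → SlotPreserving IsSum (g j)) → (g ⊚ I) ≋ g
  ⊚-identityʳ g g-cong g-add n x = begin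
    (g ⊚ I) n x                     ≡⟨ ∑<-applyUpTo (suc n) term ⟩
    ∑ (applyUpTo term (suc n))      ≈⟨ ∑applyUpTo-snoc term n ⟩
    ∑ (applyUpTo term n) + term n   ≈⟨ +-cong (∑applyUpTo-zero term n off)
                                              (blockSum-I-diag n x (g n) (g-cong n) (g-add n)) ⟩
    0# + g n x                      ≈⟨ +-identityˡ _ ⟩
    g n x                           ∎
    where
    term : ℕ → B
    term l = blockSum I l n x (g l)
    off : ∀ i → i < n → term i ≈ 0#
    off i i<n = blockSum-I-off i n x (g i) (g-add i) (λ i≡n → ℕ.<-irrefl i≡n i<n)

  ⊚-identityˡ : ∀ q → Congruentˢ q → (∀ x → q 0 x ≈ 0#) → (I ⊚ q) ≋ q
  ⊚-identityˡ q q-cong q₀ zero    x = trans (trans (+-identityʳ _) (+-identityʳ _)) (sym (q₀ x))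
  ⊚-identityˡ q q-cong q₀ (suc n) x = begin
    (I ⊚ q) (suc n) x
      ≈⟨ +-identityˡ _ ⟩
    blockSum q 1 (suc n) x (I 1) + ∑ (map term (applyUpTo (suc ∘ suc) n))
      ≈⟨ +-cong (blockSum-one q q-cong n x (I 1) (λ x≈y → x≈y F.zero))
                (trans (reflexive (∑map-applyUpTo term (suc ∘ suc) n))
                       (∑applyUpTo-zero _ n (λ i _ → ∑map-zero (blocks q (suc (suc i)) (suc n) x) (λ _ → refl)))) ⟩
    q (suc n) x + 0#
      ≈⟨ +-identityʳ _ ⟩
    q (suc n) x ∎
    where
    term : ℕ → B
    term l = blockSum q l (suc n) x (I l)

  -- Closure of G^I_B under composition

  module SP = SlotPreservation

  I-cong : Congruentˢ I
  I-cong zero          x≈y = refl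
  I-cong (suc zero)    x≈y = x≈y F.zero
  I-cong (suc (suc n)) x≈y = refl

  IsIMult-I : IsIMult I
  IsIMult-I = record
    { congruent   = I-cong
    ; additive    = SP.I-preserving sumRelation
    ; homogeneous = λ κ → SP.I-preserving (scaledRelation κ)
    ; leftLinear  = λ t → SP.I-headPreserving (leftMultipleRelation t)
    ; vanish₀     = λ _ → refl
    }

  IsIMult-⊚ : ∀ g h → IsIMult g → IsIMult h → IsIMult (g ⊚ h)
  IsIMult-⊚ g h g-IM h-IM = record
    { congruent   = λ n x≈y → ∑map-cong (upTo (suc n)) (λ l →
                      blockSum-congᵛ h h.congruent l n (g l) (g.congruent l) x≈y)
    ; additive    = SP.⊚-preserving sumRelation g h g.congruent h.congruent g.additive h.additive
    ; homogeneous = λ κ → SP.⊚-preserving (scaledRelation κ) g h g.congruent h.congruent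
                            (g.homogeneous κ) (h.homogeneous κ)
    ; leftLinear  = λ t → SP.⊚-headPreserving (leftMultipleRelation t) g h g.congruent h.congruent
                            (g.leftLinear t) (h.leftLinear t)
    ; vanish₀     = λ x → trans (+-identityʳ _) (trans (+-identityʳ _) (g.vanish₀ _))
    }
    where
    module g = IsIMult g-IM
    module h = IsIMult h-IM

  IsUnit-resp : ∀ {a a'} → a ≈ a' → IsUnit a' → IsUnit a
  IsUnit-resp a≈a' (w , a'w≈1 , wa'≈1) = w , trans (*-congʳ a≈a') a'w≈1 , trans (*-congˡ a≈a') wa'≈1

  IsUnit-* : ∀ {a c} → IsUnit a → IsUnit c → IsUnit (a * c)
  IsUnit-* {a} {c} (a⁻¹ , aa⁻¹≈1 , a⁻¹a≈1) (c⁻¹ , cc⁻¹≈1 , c⁻¹c≈1) = c⁻¹ * a⁻¹ , right , left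
    where
    right : (a * c) * (c⁻¹ * a⁻¹) ≈ 1#
    right = begin
      (a * c) * (c⁻¹ * a⁻¹) ≈⟨ *-assoc a c _ ⟩
      a * (c * (c⁻¹ * a⁻¹)) ≈⟨ *-congˡ (*-assoc c c⁻¹ a⁻¹) ⟨
      a * ((c * c⁻¹) * a⁻¹) ≈⟨ *-congˡ (*-congʳ cc⁻¹≈1) ⟩
      a * (1# * a⁻¹)        ≈⟨ *-congˡ (*-identityˡ a⁻¹) ⟩
      a * a⁻¹               ≈⟨ aa⁻¹≈1 ⟩
      1#                    ∎
    left : (c⁻¹ * a⁻¹) * (a * c) ≈ 1#
    left = begin
      (c⁻¹ * a⁻¹) * (a * c) ≈⟨ *-assoc c⁻¹ a⁻¹ _ ⟩
      c⁻¹ * (a⁻¹ * (a * c)) ≈⟨ *-congˡ (*-assoc a⁻¹ a c) ⟨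
      c⁻¹ * ((a⁻¹ * a) * c) ≈⟨ *-congˡ (*-congʳ a⁻¹a≈1) ⟩
      c⁻¹ * (1# * c)        ≈⟨ *-congˡ (*-identityˡ c) ⟩
      c⁻¹ * c               ≈⟨ c⁻¹c≈1 ⟩
      1#                    ∎

  *-cancelʳ-invertible : ∀ {u v} → u * v ≈ 1# → ∀ {x y} → x * u ≈ y * u → x ≈ y
  *-cancelʳ-invertible {u} {v} uv≈1 {x} {y} xu≈yu = begin
    x             ≈⟨ *-identityʳ x ⟨
    x * 1#        ≈⟨ *-congˡ uv≈1 ⟨
    x * (u * v)   ≈⟨ *-assoc x u v ⟨
    (x * u) * v   ≈⟨ *-congʳ xu≈yu ⟩
    (y * u) * v   ≈⟨ *-assoc y u v ⟩
    y * (u * v)   ≈⟨ *-congˡ uv≈1 ⟩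
    y * 1#        ≈⟨ *-identityʳ y ⟩
    y             ∎

  *-inverseʳ-section : ∀ {u v} → v * u ≈ 1# → ∀ y → (y * v) * u ≈ y
  *-inverseʳ-section {u} {v} vu≈1 y = begin
    (y * v) * u   ≈⟨ *-assoc y v u ⟩
    y * (v * u)   ≈⟨ *-congˡ vu≈1 ⟩
    y * 1#        ≈⟨ *-identityʳ y ⟩
    y             ∎

  GI⊆Gdif : ∀ g → GI g → Gdif g
  GI⊆Gdif g g∈GI with GI⇒linearTerm g g∈GI
  ... | u , (v , uv≈1 , vu≈1) , g₁≈*u =
    IsIMult.multilinear g-IM , IsIMult.vanish₀ g-IM V.[] , injective , surjective
    where
    g-IM = GI⇒IsIMult g g∈GI
    injective : ∀ {x y} → g 1 (x V.∷ V.[]) ≈ g 1 (y V.∷ V.[]) → x ≈ y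
    injective g₁x≈g₁y = *-cancelʳ-invertible uv≈1 (trans (sym (g₁≈*u _)) (trans g₁x≈g₁y (g₁≈*u _)))
    surjective : ∀ y → Σ B λ x → ∀ {z} → z ≈ x → g 1 (z V.∷ V.[]) ≈ y
    surjective y = y * v , λ z≈yv → trans (g₁≈*u _) (trans (*-congʳ z≈yv) (*-inverseʳ-section vu≈1 y))

  GI-I : GI I
  GI-I = IsIMult⇒GI I IsIMult-I (1# , *-identityˡ 1# , *-identityˡ 1#)

  GI-⊚ : ∀ g h → GI g → GI h → GI (g ⊚ h)
  GI-⊚ g h g∈GI h∈GI with GI⇒linearTerm g g∈GI | GI⇒linearTerm h h∈GI
  ... | u , u-unit , g₁≈*u | w , w-unit , h₁≈*w =
    IsIMult⇒GI (g ⊚ h) (IsIMult-⊚ g h g-IM h-IM) (IsUnit-resp linearTerm (IsUnit-* w-unit u-unit))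
    where
    g-IM = GI⇒IsIMult g g∈GI
    h-IM = GI⇒IsIMult h h∈GI
    module g = IsIMult g-IM
    module h = IsIMult h-IM
    linearTerm : (g ⊚ h) 1 (1# V.∷ V.[]) ≈ w * u
    linearTerm = begin
      (g ⊚ h) 1 (1# V.∷ V.[])          ≈⟨ trans (+-identityˡ _) (+-identityʳ _) ⟩
      blockSum h 1 1 (1# V.∷ V.[]) (g 1) ≈⟨ blockSum-one h h.congruent 0 _ (g 1) (g.congruent 1) ⟩
      g 1 (h 1 (1# V.∷ V.[]) V.∷ V.[]) ≈⟨ g₁≈*u _ ⟩
      h 1 (1# V.∷ V.[]) * u            ≈⟨ *-congʳ (trans (h₁≈*w _) (*-identityˡ w)) ⟩
      w * u                            ∎

  -- Inverses

  IsIMult-0 : IsIMult (λ _ _ → 0#)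
  IsIMult-0 = record
    { congruent   = λ n x≈y → refl
    ; additive    = λ n slot → LinearRelation.R-0 sumRelation
    ; homogeneous = λ κ n slot → LinearRelation.R-0 (scaledRelation κ)
    ; leftLinear  = λ t n r x≈y x≈z → LinearRelation.R-0 (leftMultipleRelation t)
    ; vanish₀     = λ _ → refl
    }

  module RightInverse (g : Series) (g-IM : IsIMult g) (u v : B) (uv≈1 : u * v ≈ 1#) (vu≈1 : v * u ≈ 1#)
                      (g₁≈*u : ∀ y → g 1 y ≈ y F.zero * u) where
    open IsIMult g-IM using () renaming (congruent to g-cong)

    -- the part of (g ⊚ h) (suc n) x with at least two blocks; it involves h_j only for j ≤ n
    higherTerms : Series → (n : ℕ) → Vector B (suc n) → B
    higherTerms h n x = ∑ (map (λ l → blockSum h l (suc n) x (g l)) (applyUpTo (suc ∘ suc) n))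

    improve : Series → Series
    improve h zero    x = 0#
    improve h (suc n) x = (I (suc n) x - higherTerms h n x) * v

    -- approx N is correct in degrees below N
    approx : ℕ → Series
    approx zero    n x = 0#
    approx (suc N) = improve (approx N)

    inverse : Series
    inverse j = approx (suc j) j

    module _ (L : LinearRelation) (h : Series) (h-cong : Congruentˢ h) where
      open LinearRelation L
      open SP L

      improve-preserving : (∀ n → SlotPreserving R (g n)) → (∀ n → SlotPreserving R (h n)) →
        ∀ n → SlotPreserving R (improve h n)
      improve-preserving g-pres h-pres (suc n) {x} {y} {z} slot =
        R-*ʳ v (R-+ (I-preserving (suc n) slot) (R-neg
          (R-∑map (applyUpTo (suc ∘ suc) n) (term x) (term y) (term z) λ l →
            blockSum-preserving h h-cong h-pres l (suc n) (g l) (g-cong l) (g-pres l) slot)))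
        where
        term : Vector B (suc n) → ℕ → B
        term w l = blockSum h l (suc n) w (g l)

      improve-headPreserving : (∀ n → HeadPreserving R (g (suc n))) → (∀ n → HeadPreserving R (h (suc n))) →
        ∀ n → HeadPreserving R (improve h (suc n))
      improve-headPreserving g-pres h-pres n {x} {y} {z} r x≈y x≈z =
        R-*ʳ v (R-+ (I-headPreserving n {x} {y} {z} r x≈y x≈z) (R-neg
          (R-∑map (applyUpTo (suc ∘ suc) n) (term x) (term y) (term z) λ
            { zero    → R-0
            ; (suc l) → blockSum-headPreserving h h-cong h-pres l n (g (suc l)) (g-cong (suc l)) (g-pres l)
                          {x} {y} {z} r x≈y x≈z })))
        where
        term : Vector B (suc n) → ℕ → B
        term w l = blockSum h l (suc n) w (g l)

    improve-cong : ∀ h → Congruentˢ h → Congruentˢ (improve h)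
    improve-cong h h-cong zero    x≈y = refl
    improve-cong h h-cong (suc n) x≈y = *-congʳ (+-cong (I-cong (suc n) x≈y) (-‿cong
      (∑map-cong (applyUpTo (suc ∘ suc) n) (λ l → blockSum-congᵛ h h-cong l (suc n) (g l) (g-cong l) x≈y))))

    IsIMult-improve : ∀ h → IsIMult h → IsIMult (improve h)
    IsIMult-improve h h-IM = record
      { congruent   = improve-cong h h.congruent
      ; additive    = improve-preserving sumRelation h h.congruent g.additive h.additive
      ; homogeneous = λ κ → improve-preserving (scaledRelation κ) h h.congruent
                              (g.homogeneous κ) (h.homogeneous κ)
      ; leftLinear  = λ t → improve-headPreserving (leftMultipleRelation t) h h.congruent
                              (g.leftLinear t) (h.leftLinear t)
      ; vanish₀     = λ _ → refl
      }
      where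
      module g = IsIMult g-IM
      module h = IsIMult h-IM

    IsIMult-approx : ∀ N → IsIMult (approx N)
    IsIMult-approx zero    = IsIMult-0
    IsIMult-approx (suc N) = IsIMult-improve (approx N) (IsIMult-approx N)

    improve-local : ∀ h h' n → (∀ j → j ≤ n → ∀ y → h j y ≈ h' j y) →
      ∀ x → improve h (suc n) x ≈ improve h' (suc n) x
    improve-local h h' n h≈h' x = *-congʳ (+-congˡ (-‿cong (begin
      higherTerms h n x
        ≡⟨ ∑map-applyUpTo _ (suc ∘ suc) n ⟩
      ∑ (applyUpTo (λ i → blockSum h (suc (suc i)) (suc n) x (g (suc (suc i)))) n)
        ≈⟨ ∑applyUpTo-cong n (λ i _ → blockSum-local₂ h h' n h≈h' i x (g (suc (suc i))) (g-cong _)) ⟩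
      ∑ (applyUpTo (λ i → blockSum h' (suc (suc i)) (suc n) x (g (suc (suc i)))) n)
        ≡⟨ ∑map-applyUpTo _ (suc ∘ suc) n ⟨
      higherTerms h' n x ∎)))

    approx-stable : ∀ N j → j < N → ∀ x → approx N j x ≈ approx (suc N) j x
    approx-stable (suc N) zero    j<N       x = refl
    approx-stable (suc N) (suc n) (s≤s n<N) x =
      improve-local (approx N) (approx (suc N)) n (λ i i≤n y → approx-stable N i (ℕ.≤-<-trans i≤n n<N) y) x

    approx-stable⁺ : ∀ d j x → approx (d +ℕ suc j) j x ≈ inverse j x
    approx-stable⁺ zero    j x = refl
    approx-stable⁺ (suc d) j x =
      trans (sym (approx-stable (d +ℕ suc j) j (ℕ.m≤n+m (suc j) d) x)) (approx-stable⁺ d j x)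

    inverse-fixed : ∀ n x → inverse (suc n) x ≈ improve inverse (suc n) x
    inverse-fixed n x = improve-local (approx (suc n)) inverse n approx≈inverse x
      where
      approx≈inverse : ∀ i → i ≤ n → ∀ y → approx (suc n) i y ≈ inverse i y
      approx≈inverse i i≤n y =
        ≡.subst (λ N → approx N i y ≈ inverse i y) (ℕ.m∸n+n≡m (s≤s i≤n)) (approx-stable⁺ (suc n ∸ suc i) i y)

    IsIMult-inverse : IsIMult inverse
    IsIMult-inverse = record
      { congruent   = λ j → IsIMult.congruent (IsIMult-approx (suc j)) j
      ; additive    = λ j → IsIMult.additive (IsIMult-approx (suc j)) j
      ; homogeneous = λ κ j → IsIMult.homogeneous (IsIMult-approx (suc j)) κ j
      ; leftLinear  = λ t j {x} {y} {z} → IsIMult.leftLinear (IsIMult-approx (suc (suc j))) t j {x} {y} {z}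
      ; vanish₀     = λ _ → refl
      }

    GI-inverse : GI inverse
    GI-inverse = IsIMult⇒GI inverse IsIMult-inverse (IsUnit-resp linearTerm (u , vu≈1 , uv≈1))
      where
      linearTerm : inverse 1 (1# V.∷ V.[]) ≈ v
      linearTerm = trans (*-congʳ (trans (+-congˡ ε⁻¹≈ε) (+-identityʳ _))) (*-identityˡ v)

    inverse-isRightInverse : (g ⊚ inverse) ≋ I
    inverse-isRightInverse zero    x = trans (+-identityʳ _) (trans (+-identityʳ _) (IsIMult.vanish₀ g-IM _))
    inverse-isRightInverse (suc n) x = begin
      (g ⊚ inverse) (suc n) x                                 ≈⟨ +-identityˡ _ ⟩
      blockSum inverse 1 (suc n) x (g 1) + higherTerms inverse n x ≈⟨ +-congʳ linearPart ⟩
      (I (suc n) x - higherTerms inverse n x) + higherTerms inverse n x ≈⟨ +-assoc _ _ _ ⟩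
      I (suc n) x + (- higherTerms inverse n x + higherTerms inverse n x) ≈⟨ +-congˡ (-‿inverseˡ _) ⟩
      I (suc n) x + 0#                                        ≈⟨ +-identityʳ _ ⟩
      I (suc n) x                                             ∎
      where
      linearPart : blockSum inverse 1 (suc n) x (g 1) ≈ I (suc n) x - higherTerms inverse n x
      linearPart = begin
        blockSum inverse 1 (suc n) x (g 1)
          ≈⟨ blockSum-one inverse (IsIMult.congruent IsIMult-inverse) n x (g 1) (g-cong 1) ⟩
        g 1 (inverse (suc n) x V.∷ V.[])          ≈⟨ g₁≈*u _ ⟩
        inverse (suc n) x * u                     ≈⟨ *-congʳ (inverse-fixed n x) ⟩
        ((I (suc n) x - higherTerms inverse n x) * v) * u ≈⟨ *-inverseʳ-section vu≈1 _ ⟩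
        I (suc n) x - higherTerms inverse n x     ∎

  GI-rightInverse : ∀ g → GI g → Σ Series λ h → GI h × ((g ⊚ h) ≋ I)
  GI-rightInverse g g∈GI with GI⇒linearTerm g g∈GI
  ... | u , (v , uv≈1 , vu≈1) , g₁≈*u = inverse , GI-inverse , inverse-isRightInverse
    where open RightInverse g (GI⇒IsIMult g g∈GI) u v uv≈1 vu≈1 g₁≈*u

  -- a right inverse h of g has a right inverse g', and g ≋ g ⊚ (h ⊚ g') ≋ (g ⊚ h) ⊚ g' ≋ g'
  GI-inverse : ∀ g → GI g → Σ Series λ h → GI h × ((g ⊚ h) ≋ I) × ((h ⊚ g) ≋ I)
  GI-inverse g g∈GI with GI-rightInverse g g∈GI
  ... | h , h∈GI , gh≋I with GI-rightInverse h h∈GI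
  ... | g' , g'∈GI , hg'≋I =
    h , h∈GI , gh≋I , λ n x → trans (⊚-congʳ h g g' h.congruent g≋g' n x) (hg'≋I n x)
    where
    module g  = IsIMult (GI⇒IsIMult g g∈GI)
    module h  = IsIMult (GI⇒IsIMult h h∈GI)
    module g' = IsIMult (GI⇒IsIMult g' g'∈GI)
    g≋g' : g ≋ g'
    g≋g' n x = begin
      g n x                 ≈⟨ ⊚-identityʳ g g.congruent g.additive n x ⟨
      (g ⊚ I) n x           ≈⟨ ⊚-congʳ g I (h ⊚ g') g.congruent (λ n x → sym (hg'≋I n x)) n x ⟩
      (g ⊚ (h ⊚ g')) n x    ≈⟨ ⊚-assoc g h g' g.congruent g.additive n x ⟨
      ((g ⊚ h) ⊚ g') n x    ≈⟨ ⊚-congˡ (g ⊚ h) I g' gh≋I n x ⟩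
      (I ⊚ g') n x          ≈⟨ ⊚-identityˡ g' g'.congruent g'.vanish₀ n x ⟩
      g' n x                ∎

  GI-isSubgroupOfGdif : IsSubgroupOfGdif GI
  GI-isSubgroupOfGdif = record
    { ⊆Gdif      = GI⊆Gdif
    ; has-I      = GI-I
    ; ⊚-closed   = GI-⊚
    ; inv-closed = GI-inverse
    }

lemma3p3 : ∀ {k ℓk b ℓb : Level} (K : CommutativeRing k ℓk) → IsField K → CharZero K →
    (A : UnitalAlgebra K b ℓb) → Mult.IsSubgroupOfGdif A (Mult.GI A)
lemma3p3 K _ _ A = GI-isSubgroupOfGdif A
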